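{- Let $\mathcal{R}$ be a UGTS, $k\in\mathbb{N}$ and $G$ a graph. Then $\mathrm{predBasis}_k(G)$ is a finite subset of $\mathrm{pred}(\uparrow\{G\})$, and $\mathrm{predBasis}_k(G)\subseteq\mathcal{G}_k$.
   Context: Fix a finite set $\Lambda$ of edge labels with arity $\mathrm{ar}:\Lambda\to\mathbb{N}$. A graph is $G=(V_G,E_G,c_G,l_G)$ with finite $V_G,E_G$, $c_G:E_G\to V_G^*$, $l_G:E_G\to\Lambda$, $|c_G(e)|=\mathrm{ar}(l_G(e))$; $e$ is incident to $v$ if $v$ occurs in $c_G(e)$. A morphism $\varphi:G\rightharpoonup G'$ is a pair of partial functions on nodes and edges such that whenever $\varphi_E(e)$ is defined, $\varphi_V$ is defined on all nodes of $c_G(e)$, labels are preserved and $\varphi_V(c_G(e))=c_{G'}(\varphi_E(e))$; total/injective/surjective if both components are. Pushout of $\varphi:G_0\rightharpoonup G_1,\psi:G_0\rightharpoonup G_2$ (category of graphs and partial morphisms): $G_3$ with $\psi':G_1\rightharpoonup G_3$, $\varphi':G_2\rightharpoonup G_3$, $\psi'\circ\varphi=\varphi'\circ\psi$, universal. Pushout complement of $\varphi:G_0\rightharpoonup G_1$ and $\psi':G_1\rightharpoonup G_3$: $G_2$ with $\psi:G_0\rightharpoonup G_2$, $\varphi':G_2\rightharpoonup G_3$ making $(G_3,\psi',\varphi')$ a pushout of $\varphi,\psi$. Subgraph morphism: partial, injective, surjective; $G_1\sqsubseteq G_2$ iff there is one $G_2\rightharpoonup G_1$. $\uparrow\mathcal{S}=\{G'\mid\exists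 G\in\mathcal{S}:G\sqsubseteq G'\}$. Undirected path of length $n$: $v_0,e_1,\dots,e_n,v_n$ pairwise distinct with $v_{i-1},v_i$ incident to $e_i$; $\mathcal{G}_k$: graphs all of whose undirected paths have length $\le k$. Universally quantified rule $\rho=(r,U)$: $r:L\rightharpoonup R$, $U$ finite set of $u=(p_u,q_u)$, $p_u:L\to L_u$ total injective, $q_u:L_u\rightharpoonup R_u$, with $q_u(p_u(x))$ defined and having exactly one preimage under $q_u$ for each element $x$ of $L$; $\mathrm{qNodes}(u)=\{v\in V_L\mid$ some edge incident to $p_u(v)$ has no $p_u$-preimage$\}\ne\emptyset$, $\mathrm{qNodes}(\rho)=\bigcup_u\mathrm{qNodes}(u)$. Instantiations $(\pi:L\to\bar L,\gamma:\bar L\rightharpoonup\bar R)$: $(\mathrm{id}_L,r)$ of length $0$; from $(\pi,\gamma)$ of length $n$ and $u\in U$: pushout $(\bar L_u,p'_u,\pi')$ of $\pi,p_u$; pushout $(\bar R_u,\sigma,\tau)$ of $\gamma\circ\pi$ and $q_u\circ p_u$; $\eta:\bar L_u\rightharpoonup\bar R_u$ unique with $\eta\circ p'_u=\sigma\circ\gamma$, $\eta\circ\pi'=\tau\circ q_u$; $(p'_u\circ\pi,\eta)$ has length $n+1$. $G\Rightarrow H$ via $\rho$ if some instantiation $(\pi,\gamma)$ and total injective $m:\bar L\to G$ satisfy: for every $x\in\mathrm{qNodes}(\rho)$ every edge incident to $m(\pi(x))$ has an $m$-preimage (application condition), and $H$ is the pushout of $m$ and $\gamma$. A UGTS $\mathcal{R}$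 is a finite set of such rules; $\mathrm{pred}(\mathcal{S})=\{G'\mid\exists G\in\mathcal{S}:G'\Rightarrow G\}$. $\mathrm{predBasis}_k(G)$: for every $\rho\in\mathcal{R}$: (1) all instantiations $(\pi,\gamma)$ of length at most $|V_G|+|E_G|$; (2) all subgraph morphisms $\mu:\bar R\rightharpoonup R'$ (one $R'$ per iso class); (3) all total injective $m':R'\to G$; (4) all minimal (w.r.t. $\sqsubseteq$) pushout complements $G'$ of $\mu\circ\gamma$ and $m'$ with total injective $m:\bar L\to G'$ and $G'\in\mathcal{G}_k$, dropping those where $m$ violates the application condition. $\mathrm{predBasis}_k(G)$ is the set of all non-dropped $G'$. -}

module Defs where

open import Data.Nat using (ℕ; zero; suc; _+_; _≤_)
open import Data.Fin using (Fin; inject₁) renaming (suc to fsuc)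
open import Data.List using (List; []; _∷_; map; length)
open import Data.List.Properties using (∷-injective)
open import Data.List.Membership.Propositional using (_∈_)
open import Data.Maybe using (Maybe; just; nothing; _>>=_; Is-just)
open import Data.Maybe.Properties using (just-injective)
open import Data.Product using (Σ; ∃; ∃-syntax; _×_; _,_; proj₁; proj₂)
open import Relation.Nullary using (¬_)
open import Relation.Binary.PropositionalEquality using (_≡_; refl; sym; trans; cong; cong₂)
open import Function.Definitions using (Injective)

record Sig : Set where
  field
    nLab : ℕ
    ar   : Fin nLab → ℕ

private
  mapBind : ∀ {A B C : Set} (f : A → Maybe B) (g : B → Maybe C)
            (xs : List A) (ys : List B) (zs : List C) →
            map f xs ≡ map just ys → map g ys ≡ map just zs →
            map (λ x → f x >>= g) xs ≡ map just zs
  mapBind f g [] [] zs p q = q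
  mapBind f g [] (y ∷ ys) zs () q
  mapBind f g (x ∷ xs) [] zs () q
  mapBind f g (x ∷ xs) (y ∷ ys) [] p ()
  mapBind f g (x ∷ xs) (y ∷ ys) (z ∷ zs) p q
    with ∷-injective p | ∷-injective q
  ... | fx , p' | gy , q' =
    cong₂ _∷_ (trans (cong (_>>= g) fx) gy) (mapBind f g xs ys zs p' q')

  bindJust : ∀ {A B : Set} (m : Maybe A) (g : A → Maybe B) {b : B} →
             (m >>= g) ≡ just b → ∃[ a ] (m ≡ just a × g a ≡ just b)
  bindJust (just a) g eq = a , refl , eq
  bindJust nothing g ()

module _ (S : Sig) where
  open Sig S

  -- Hypergraphs: nodes Fin nV, edges Fin nE, attachment c, labelling l.
  record Graph : Set where
    field
      nV    : ℕ
      nE    : ℕ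
      att   : Fin nE → List (Fin nV)
      lab   : Fin nE → Fin nLab
      arity : ∀ e → length (att e) ≡ ar (lab e)
  open Graph public

  Incident : (G : Graph) → Fin (nV G) → Fin (nE G) → Set
  Incident G v e = v ∈ att G e

  IsMor : (G H : Graph) → (Fin (nV G) → Maybe (Fin (nV H))) →
          (Fin (nE G) → Maybe (Fin (nE H))) → Set
  IsMor G H fV fE = ∀ e e' → fE e ≡ just e' →
    lab H e' ≡ lab G e × map fV (att G e) ≡ map just (att H e')

  record PMor (G H : Graph) : Set where
    field
      mV  : Fin (nV G) → Maybe (Fin (nV H))
      mE  : Fin (nE G) → Maybe (Fin (nE H))
      mor : IsMor G H mV mE
  open PMor public

  idₘ : {G : Graph} → PMor G G
  idₘ {G} = record { mV = just ; mE = just ; mor = λ { e .e refl → refl , refl } }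

  infixr 9 _∘ₘ_
  _∘ₘ_ : {G H K : Graph} → PMor H K → PMor G H → PMor G K
  _∘ₘ_ {G} {H} {K} ψ φ = record
    { mV = λ v → mV φ v >>= mV ψ
    ; mE = λ e → mE φ e >>= mE ψ
    ; mor = ok }
    where
    ok : IsMor G K (λ v → mV φ v >>= mV ψ) (λ e → mE φ e >>= mE ψ)
    ok e e'' eq with bindJust (mE φ e) (mE ψ) eq
    ... | e' , p , q with mor φ e e' p | mor ψ e' e'' q
    ... | l1 , a1 | l2 , a2 =
      trans l2 l1 , mapBind (mV φ) (mV ψ) (att G e) (att H e') (att K e'') a1 a2

  infix 4 _≈ₘ_
  _≈ₘ_ : {G H : Graph} → PMor G H → PMor G H → Set
  φ ≈ₘ ψ = (∀ v → mV φ v ≡ mV ψ v) × (∀ e → mE φ e ≡ mE ψ e)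

  PInjective : {A B : Set} → (A → Maybe B) → Set
  PInjective f = ∀ x y z → f x ≡ just z → f y ≡ just z → x ≡ y

  PSurjective : {A B : Set} → (A → Maybe B) → Set
  PSurjective {A} f = ∀ y → ∃[ x ] (f x ≡ just y)

  Total : {G H : Graph} → PMor G H → Set
  Total φ = (∀ v → Is-just (mV φ v)) × (∀ e → Is-just (mE φ e))

  Inj : {G H : Graph} → PMor G H → Set
  Inj φ = PInjective (mV φ) × PInjective (mE φ)

  Surj : {G H : Graph} → PMor G H → Set
  Surj φ = PSurjective (mV φ) × PSurjective (mE φ)

  TotInj : {G H : Graph} → PMor G H → Set
  TotInj φ = Total φ × Inj φ

  SubgraphMor : {G H : Graph} → PMor G H → Set
  SubgraphMor φ = Inj φ × Surj φ

  _⊑_ : Graph → Graph → Set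
  G₁ ⊑ G₂ = Σ (PMor G₂ G₁) SubgraphMor

  _≅_ : Graph → Graph → Set
  G ≅ H = Σ (PMor G H) λ f → Σ (PMor H G) λ g → ((g ∘ₘ f) ≈ₘ idₘ) × ((f ∘ₘ g) ≈ₘ idₘ)

  IsPushout : {G₀ G₁ G₂ G₃ : Graph} →
              PMor G₀ G₁ → PMor G₀ G₂ → PMor G₁ G₃ → PMor G₂ G₃ → Set
  IsPushout {G₀} {G₁} {G₂} {G₃} φ ψ ψ' φ' =
    ((ψ' ∘ₘ φ) ≈ₘ (φ' ∘ₘ ψ)) ×
    ((H : Graph) → (a : PMor G₁ H) → (b : PMor G₂ H) → (a ∘ₘ φ) ≈ₘ (b ∘ₘ ψ) →
      Σ (PMor G₃ H) λ χ → ((χ ∘ₘ ψ') ≈ₘ a × (χ ∘ₘ φ') ≈ₘ b) ×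
        (∀ (χ' : PMor G₃ H) → (χ' ∘ₘ ψ') ≈ₘ a → (χ' ∘ₘ φ') ≈ₘ b → χ' ≈ₘ χ))

  InQNodesU : {L Lu : Graph} → PMor L Lu → Fin (nV L) → Set
  InQNodesU {L} {Lu} p v = ∃[ w ] (mV p v ≡ just w × ∃[ e ] (Incident Lu w e × ¬ (∃[ e₀ ] (mE p e₀ ≡ just e))))

  record QUnit (L : Graph) : Set where
    field
      Lu   : Graph
      Ru   : Graph
      p    : PMor L Lu
      q    : PMor Lu Ru
      p-totinj : TotInj p
      q-condV : ∀ x → ∃[ y ] ((mV p x >>= mV q) ≡ just y × (∀ z → mV q z ≡ just y → mV p x ≡ just z))
      q-condE : ∀ x → ∃[ y ] ((mE p x >>= mE q) ≡ just y × (∀ z → mE q z ≡ just y → mE p x ≡ just z))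
      qNodes-nonempty : ∃[ v ] InQNodesU p v
  open QUnit public

  -- universally quantified rule ρ = (r, U), U a finite set (given as a list)
  record Rule : Set where
    field
      L : Graph
      R : Graph
      r : PMor L R
      U : List (QUnit L)
  open Rule public

  qNodes : (ρ : Rule) → Fin (nV (L ρ)) → Set
  qNodes ρ v = ∃[ u ] (u ∈ U ρ × InQNodesU (p u) v)

  data Inst (ρ : Rule) : ℕ → (Lb : Graph) → PMor (L ρ) Lb → (Rb : Graph) → PMor Lb Rb → Set where
    inst0 : Inst ρ 0 (L ρ) idₘ (R ρ) (r ρ)
    instS : ∀ {n Lb π Rb γ} → Inst ρ n Lb π Rb γ →
            (u : QUnit (L ρ)) → u ∈ U ρ →
            (Lbu : Graph) (p' : PMor Lb Lbu) (π' : PMor (Lu u) Lbu) →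
            IsPushout π (p u) p' π' →
            (Rbu : Graph) (σ : PMor Rb Rbu) (τ : PMor (Ru u) Rbu) →
            IsPushout (γ ∘ₘ π) (q u ∘ₘ p u) σ τ →
            (η : PMor Lbu Rbu) → (η ∘ₘ p') ≈ₘ (σ ∘ₘ γ) → (η ∘ₘ π') ≈ₘ (τ ∘ₘ q u) →
            Inst ρ (suc n) Lbu (p' ∘ₘ π) Rbu η

  AppCond : (ρ : Rule) {Lb G : Graph} → PMor (L ρ) Lb → PMor Lb G → Set
  AppCond ρ {Lb} {G} π m = ∀ x → qNodes ρ x → ∀ w → (mV π x >>= mV m) ≡ just w →
    ∀ e → Incident G w e → ∃[ e₀ ] (mE m e₀ ≡ just e)

  Step : Rule → Graph → Graph → Set
  Step ρ G H = ∃[ n ] Σ Graph λ Lb → Σ (PMor (L ρ) Lb) λ π → Σ Graph λ Rb → Σ (PMor Lb Rb) λ γ →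
    Inst ρ n Lb π Rb γ × Σ (PMor Lb G) λ m → TotInj m × AppCond ρ π m ×
    Σ (PMor G H) λ ψ' → Σ (PMor Rb H) λ φ' → IsPushout m γ ψ' φ'

  UGTS : Set
  UGTS = List Rule

  pred : UGTS → (Graph → Set) → Graph → Set
  pred 𝓡 P G' = Σ Graph λ G → P G × ∃[ ρ ] (ρ ∈ 𝓡 × Step ρ G' G)

  up1 : Graph → Graph → Set
  up1 G G' = G ⊑ G'

  IsPath : (G : Graph) (n : ℕ) → (Fin (suc n) → Fin (nV G)) → (Fin n → Fin (nE G)) → Set
  IsPath G n vs es = Injective _≡_ _≡_ vs × Injective _≡_ _≡_ es ×
    (∀ i → Incident G (vs (inject₁ i)) (es i) × Incident G (vs (fsuc i)) (es i))

  InGk : ℕ → Graph → Set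
  InGk k G = ∀ n vs es → IsPath G n vs es → n ≤ k

  POCk : ℕ → {Lb R' G : Graph} → PMor Lb R' → PMor R' G → (G' : Graph) → PMor Lb G' → Set
  POCk k {Lb} {R'} {G} φ ψ' G' m = TotInj m × InGk k G' × Σ (PMor G' G) λ φ' → IsPushout φ m ψ' φ'

  InPredBasis : UGTS → ℕ → Graph → Graph → Set
  InPredBasis 𝓡 k G G' = ∃[ ρ ] (ρ ∈ 𝓡 × ∃[ n ] (n ≤ nV G + nE G ×
    Σ Graph λ Lb → Σ (PMor (L ρ) Lb) λ π → Σ Graph λ Rb → Σ (PMor Lb Rb) λ γ →
    Inst ρ n Lb π Rb γ ×
    Σ Graph λ R' → Σ (PMor Rb R') λ μ → SubgraphMor μ ×
    Σ (PMor R' G) λ m' → TotInj m' ×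
    Σ (PMor Lb G') λ m → POCk k (μ ∘ₘ γ) m' G' m ×
      (∀ G'' → Σ (PMor Lb G'') (POCk k (μ ∘ₘ γ) m' G'') → G'' ⊑ G' → G' ⊑ G'') ×
      AppCond ρ π m))

  FiniteUpToIso : (Graph → Set) → Set
  FiniteUpToIso P = Σ (List Graph) λ gs → ∀ G' → P G' → Σ Graph λ G'' → G'' ∈ gs × G' ≅ G''

module Submission where

-- Containment in 𝒢_k is part of the definition of the basis.  For the predecessor property,
-- the match m : L̄ → G' is pushed out along γ : L̄ ⇀ R̄ explicitly, giving a step G' ⇒ H;
-- since G is the pushout of μ ∘ γ and m, the induced morphism H ⇀ G is injective and
-- surjective, i.e. G ⊑ H.  For finiteness, every basis element has bounded size: pushouts
-- are jointly surjective, which bounds instantiations of bounded length; the nodes of a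
-- pushout complement G' are covered by the image of m and (injectively) by G; and a
-- ⊑-minimal complement has no dangling edges -- deleting one would give a smaller
-- complement -- which bounds its edges in the same way.  Up to isomorphism there are only
-- finitely many graphs of bounded size.

open import Defs

open import Data.Bool using (Bool; true; false; _∧_; not)
open import Data.Nat using (ℕ; zero; suc; _+_; _*_; _⊔_; _≤_; _<_; z≤n; s≤s)
open import Data.Nat.Properties using (m≤n⇒m≤1+n; m≤m⊔n; m≤n⇒m≤o⊔n; m≤m+n; ≤-trans; +-mono-≤; +-monoˡ-≤; +-monoʳ-≤; *-monoˡ-≤; +-assoc; +-comm; <⇒≱; module ≤-Reasoning)
open import Data.Fin using (Fin; join; splitAt; _↑ˡ_; _↑ʳ_) renaming (zero to fzero; suc to fsuc)
open import Data.Fin.Properties using (any?; injective⇒≤; splitAt-join; splitAt-↑ˡ; splitAt-↑ʳ; splitAt⁻¹-↑ˡ; splitAt⁻¹-↑ʳ; ↑ʳ-injective) renaming (_≟_ to _≟F_)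
open import Data.List using (List; []; _∷_; map; length; concatMap; allFin; upTo; foldr)
open import Data.Bool.ListAction using (all)
open import Data.List.Properties using (∷-injective; map-∘; map-cong; map-cong-local; length-map)
open import Data.List.Relation.Unary.All using (All)
import Data.List.Relation.Unary.All as All
open import Data.List.Relation.Unary.All.Properties using (¬All⇒Any¬)
open import Data.List.Membership.Propositional using (_∈_; find)
open import Data.List.Membership.Propositional.Properties using (∈-map⁺; ∈-map⁻; ∈-concat⁺′; ∈-allFin; ∈-upTo⁺)
open import Data.List.Relation.Unary.Any using (here; there)
open import Data.Maybe using (Maybe; just; nothing; _>>=_; Is-just)
import Data.Maybe as Maybe
import Data.Maybe.Relation.Unary.Any as MaybeAny
open import Data.Maybe.Properties using (just-injective; ≡-dec)
open import Data.Product using (Σ; ∃-syntax; _×_; _,_; proj₁; proj₂)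
open import Data.Sum using (_⊎_; inj₁; inj₂; [_,_]′)
open import Relation.Nullary using (¬_; Dec; yes; no; does)
open import Relation.Nullary.Decidable using (_⊎-dec_; dec-true; dec-false)
open import Data.Empty using (⊥; ⊥-elim)
open import Relation.Binary.PropositionalEquality using (_≡_; refl; sym; trans; cong; cong₂; module ≡-Reasoning)
open import Function.Definitions using (Injective)
open import Function.Base using (case_of_)

private variable
  A B C : Set

>>=-identityʳ : (m : Maybe A) → (m >>= just) ≡ m
>>=-identityʳ (just x) = refl
>>=-identityʳ nothing  = refl

>>=-assoc : (m : Maybe A) (f : A → Maybe B) (g : B → Maybe C) →
  ((m >>= f) >>= g) ≡ (m >>= λ x → f x >>= g)
>>=-assoc (just x) f g = refl
>>=-assoc nothing  f g = refl

>>=-cong : (m : Maybe A) {f g : A → Maybe B} → (∀ x → f x ≡ g x) → (m >>= f) ≡ (m >>= g)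
>>=-cong (just x) f≗g = f≗g x
>>=-cong nothing  f≗g = refl

>>=-just⁻ : (m : Maybe A) (g : A → Maybe B) {b : B} →
  (m >>= g) ≡ just b → ∃[ a ] (m ≡ just a × g a ≡ just b)
>>=-just⁻ (just a) g eq = a , refl , eq

map-as->>= : (f : A → B) (m : Maybe A) → Maybe.map f m ≡ (m >>= λ x → just (f x))
map-as->>= f (just x) = refl
map-as->>= f nothing  = refl

Is-just⇒≡ : {m : Maybe A} → Is-just m → ∃[ a ] (m ≡ just a)
Is-just⇒≡ (MaybeAny.just {x = x} _) = x , refl

≡⇒Is-just : {m : Maybe A} {a : A} → m ≡ just a → Is-just m
≡⇒Is-just refl = MaybeAny.just _

preimage? : ∀ {a n} (f : Fin a → Maybe (Fin n)) (y : Fin n) → Dec (∃[ x ] (f x ≡ just y))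
preimage? f y = any? (λ x → ≡-dec _≟F_ (f x) (just y))

isJust? : (m : Maybe A) → Dec (∃[ a ] (m ≡ just a))
isJust? (just a) = yes (a , refl)
isJust? nothing  = no λ ()

mapJust-∈⁻ : (f : A → Maybe B) (xs : List A) (ys : List B) → map f xs ≡ map just ys →
  ∀ {y} → y ∈ ys → ∃[ x ] (x ∈ xs × f x ≡ just y)
mapJust-∈⁻ f (x ∷ xs) (y ∷ ys) eq (here refl) = x , here refl , proj₁ (∷-injective eq)
mapJust-∈⁻ f (x ∷ xs) (y ∷ ys) eq (there p) =
  let x' , x'∈ , fx' = mapJust-∈⁻ f xs ys (proj₂ (∷-injective eq)) p in x' , there x'∈ , fx'

mapJust-∈⁺ : (f : A → Maybe B) (xs : List A) (ys : List B) → map f xs ≡ map just ys →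
  ∀ {x} → x ∈ xs → ∃[ y ] (y ∈ ys × f x ≡ just y)
mapJust-∈⁺ f (x ∷ xs) (y ∷ ys) eq (here refl) = y , here refl , proj₁ (∷-injective eq)
mapJust-∈⁺ f (x ∷ xs) (y ∷ ys) eq (there p) =
  let y' , y'∈ , fy' = mapJust-∈⁺ f xs ys (proj₂ (∷-injective eq)) p in y' , there y'∈ , fy'

mapJust-zip : ∀ {D : Set} (f : A → Maybe B) (g : A → Maybe C) (k : B → D) (h : C → D) xs ys zs →
  map f xs ≡ map just ys → map g xs ≡ map just zs →
  (∀ x y z → f x ≡ just y → g x ≡ just z → k y ≡ h z) → map k ys ≡ map h zs
mapJust-zip f g k h [] [] [] p q r = refl
mapJust-zip f g k h (x ∷ xs) (y ∷ ys) (z ∷ zs) p q r =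
  let fx , p' = ∷-injective p ; gx , q' = ∷-injective q in
  cong₂ _∷_ (r x y z fx gx) (mapJust-zip f g k h xs ys zs p' q' r)

all-true : (p : A → Bool) (xs : List A) → all p xs ≡ true → ∀ {x} → x ∈ xs → p x ≡ true
all-true p (x ∷ xs) eq (here refl) with p x
... | true = refl
all-true p (y ∷ xs) eq (there q) with p y
... | true = all-true p xs eq q

all-false : (p : A → Bool) (xs : List A) → all p xs ≡ false → ∃[ x ] (x ∈ xs × p x ≡ false)
all-false p (x ∷ xs) eq with p x in px
... | false = x , here refl , px
... | true  = let y , y∈ , py = all-false p xs eq in y , there y∈ , py

all-intro : (p : A → Bool) (xs : List A) → (∀ x → x ∈ xs → p x ≡ true) → all p xs ≡ true
all-intro p []       h = refl
all-intro p (x ∷ xs) h rewrite h x (here refl) = all-intro p xs (λ y q → h y (there q))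

∧-trueˡ : ∀ {a b} → a ∧ b ≡ true → a ≡ true
∧-trueˡ {true} _ = refl

∧-trueʳ : ∀ {a b} → a ∧ b ≡ true → b ≡ true
∧-trueʳ {true} eq = eq

isNo : {P : Set} → Dec P → Bool
isNo d = not (does d)

isNo-true : {P : Set} (d : Dec P) → isNo d ≡ true → ¬ P
isNo-true (no ¬p) _ = ¬p

injection⊎-bound : ∀ {n a b} (g : Fin n → Fin a ⊎ Fin b) → (∀ x y → g x ≡ g y → x ≡ y) → n ≤ a + b
injection⊎-bound {n} {a} {b} g inj = injective⇒≤ {f = λ x → join a b (g x)} λ {x} {y} eq →
  inj x y (trans (sym (splitAt-join a b (g x)))
          (trans (cong (splitAt a) eq) (splitAt-join a b (g y))))

cover-bound : ∀ {n a b} (f : Fin a → Maybe (Fin n)) (g : Fin b → Maybe (Fin n)) →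
  (∀ y → (∃[ x ] (f x ≡ just y)) ⊎ (∃[ x ] (g x ≡ just y))) → n ≤ a + b
cover-bound {n} {a} {b} f g cov = injection⊎-bound choose choose-injective
  where
  choose : Fin n → Fin a ⊎ Fin b
  choose y with cov y
  ... | inj₁ (x , _) = inj₁ x
  ... | inj₂ (x , _) = inj₂ x
  choose-injective : ∀ x y → choose x ≡ choose y → x ≡ y
  choose-injective x y eq with cov x | cov y
  choose-injective x y refl | inj₁ (x₁ , p) | inj₁ (.x₁ , q) = just-injective (trans (sym p) q)
  choose-injective x y ()   | inj₁ _ | inj₂ _
  choose-injective x y ()   | inj₂ _ | inj₁ _
  choose-injective x y refl | inj₂ (x₁ , p) | inj₂ (.x₁ , q) = just-injective (trans (sym p) q)

surjection-bound : ∀ {n a} (f : Fin a → Maybe (Fin n)) → (∀ y → ∃[ x ] (f x ≡ just y)) → n ≤ a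
surjection-bound f s = injective⇒≤ {f = λ y → proj₁ (s y)} λ {x} {y} eq →
  just-injective (trans (sym (proj₂ (s x))) (trans (cong f eq) (proj₂ (s y))))

↑ˡ≢↑ʳ : ∀ {m n} {x : Fin m} {y : Fin n} → x ↑ˡ n ≡ m ↑ʳ y → ⊥
↑ˡ≢↑ʳ {m} {n} {x} {y} eq with trans (sym (splitAt-↑ˡ m x n)) (trans (cong (splitAt m) eq) (splitAt-↑ʳ m n y))
... | ()

partialId : ∀ {n} {P : Fin n → Set} → (∀ y → Dec (P y)) → Fin n → Maybe (Fin n)
partialId d y with d y
... | yes _ = just y
... | no _  = nothing

partialId-yes : ∀ {n} {P : Fin n → Set} (d : ∀ y → Dec (P y)) y → P y → partialId d y ≡ just y
partialId-yes d y p with d y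
... | yes _ = refl
... | no ¬p = ⊥-elim (¬p p)

partialId-just : ∀ {n} {P : Fin n → Set} (d : ∀ y → Dec (P y)) y z → partialId d y ≡ just z → P y × y ≡ z
partialId-just d y z eq with d y
partialId-just d y .y refl | yes p = p , refl

private
  tail : ∀ {n} → (Fin (suc n) → Bool) → Fin n → Bool
  tail P i = P (fsuc i)

count : ∀ n → (Fin n → Bool) → ℕ
count zero    P = 0
count (suc n) P with P fzero
... | true  = suc (count n (tail P))
... | false = count n (tail P)

embed : ∀ n P → Fin (count n P) → Fin n
embed (suc n) P i with P fzero
embed (suc n) P fzero    | true = fzero
embed (suc n) P (fsuc i) | true = fsuc (embed n (tail P) i)
embed (suc n) P i        | false = fsuc (embed n (tail P) i)

index : ∀ n P → Fin n → Maybe (Fin (count n P))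
index (suc n) P y with P fzero
index (suc n) P fzero    | true  = just fzero
index (suc n) P fzero    | false = nothing
index (suc n) P (fsuc y) | true  = Maybe.map fsuc (index n (tail P) y)
index (suc n) P (fsuc y) | false = index n (tail P) y

index-embed : ∀ n P i → index n P (embed n P i) ≡ just i
index-embed (suc n) P i with P fzero
index-embed (suc n) P fzero    | true = refl
index-embed (suc n) P (fsuc i) | true rewrite index-embed n (tail P) i = refl
index-embed (suc n) P i        | false = index-embed n (tail P) i

embed-index : ∀ n P y i → index n P y ≡ just i → embed n P i ≡ y
embed-index (suc n) P y i eq with P fzero
embed-index (suc n) P fzero .fzero refl | true = refl
embed-index (suc n) P (fsuc y) i eq | true with index n (tail P) y in e
embed-index (suc n) P (fsuc y) .(fsuc j) refl | true | just j = cong fsuc (embed-index n (tail P) y j e)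
embed-index (suc n) P (fsuc y) i eq | false = cong fsuc (embed-index n (tail P) y i eq)

index-true : ∀ n P y → P y ≡ true → ∃[ i ] (index n P y ≡ just i)
index-true (suc n) P y eq with P fzero in e0
index-true (suc n) P fzero eq | true = fzero , refl
index-true (suc n) P fzero eq | false with trans (sym e0) eq
... | ()
index-true (suc n) P (fsuc y) eq | true =
  let i , e = index-true n (tail P) y eq in fsuc i , cong (Maybe.map fsuc) e
index-true (suc n) P (fsuc y) eq | false = index-true n (tail P) y eq

index-false : ∀ n P y → P y ≡ false → index n P y ≡ nothing
index-false (suc n) P y eq with P fzero in e0
index-false (suc n) P fzero eq | true with trans (sym e0) eq
... | ()
index-false (suc n) P fzero eq | false = refl
index-false (suc n) P (fsuc y) eq | true rewrite index-false n (tail P) y eq = refl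
index-false (suc n) P (fsuc y) eq | false = index-false n (tail P) y eq

index⇒true : ∀ n P y i → index n P y ≡ just i → P y ≡ true
index⇒true n P y i eq with P y in e
... | true = refl
... | false with trans (sym (index-false n P y e)) eq
... | ()

embed-true : ∀ n P i → P (embed n P i) ≡ true
embed-true n P i = index⇒true n P (embed n P i) i (index-embed n P i)

embed-injective : ∀ n P i j → embed n P i ≡ embed n P j → i ≡ j
embed-injective n P i j eq =
  just-injective (trans (sym (index-embed n P i)) (trans (cong (index n P) eq) (index-embed n P j)))

index-injective : ∀ n P x y i → index n P x ≡ just i → index n P y ≡ just i → x ≡ y
index-injective n P x y i p q = trans (sym (embed-index n P x i p)) (embed-index n P y i q)

index->>=-embed : ∀ {X : Set} n P (f : Fin n → Maybe X) y i → index n P y ≡ just i →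
  (index n P y >>= λ j → f (embed n P j)) ≡ f y
index->>=-embed n P f y i eq rewrite eq = cong f (embed-index n P y i eq)

count-≤ : ∀ n P → count n P ≤ n
count-≤ zero    P = z≤n
count-≤ (suc n) P with P fzero
... | true  = s≤s (count-≤ n (tail P))
... | false = m≤n⇒m≤1+n (count-≤ n (tail P))

count-< : ∀ n P y → P y ≡ false → count n P < n
count-< (suc n) P y eq with P fzero in e0
count-< (suc n) P fzero    eq | true with trans (sym e0) eq
... | ()
count-< (suc n) P fzero    eq | false = s≤s (count-≤ n (tail P))
count-< (suc n) P (fsuc y) eq | true  = s≤s (count-< n (tail P) y eq)
count-< (suc n) P (fsuc y) eq | false = m≤n⇒m≤1+n (count-< n (tail P) y eq)

∈-concatMap⁺ : {f : A → List B} {x : A} {xs : List A} {y : B} → y ∈ f x → x ∈ xs → y ∈ concatMap f xs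
∈-concatMap⁺ {f = f} p q = ∈-concat⁺′ p (∈-map⁺ f q)

consFun : ∀ {b} → A → (Fin b → A) → Fin (suc b) → A
consFun x f fzero    = x
consFun x f (fsuc i) = f i

functions : (b : ℕ) → List A → List (Fin b → A)
functions zero    xs = (λ ()) ∷ []
functions (suc b) xs = concatMap (λ x → map (consFun x) (functions b xs)) xs

functions-complete : ∀ b (xs : List A) (g : Fin b → A) → (∀ i → g i ∈ xs) →
  ∃[ f ] (f ∈ functions b xs × ∀ i → f i ≡ g i)
functions-complete zero    xs g h = (λ ()) , here refl , λ ()
functions-complete (suc b) xs g h =
  let f , f∈ , f≗ = functions-complete b xs (λ i → g (fsuc i)) (λ i → h (fsuc i)) in
  consFun (g fzero) f ,
  ∈-concatMap⁺ {f = λ x → map (consFun x) (functions b xs)} (∈-map⁺ (consFun (g fzero)) f∈) (h fzero) ,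
  λ { fzero → refl ; (fsuc i) → f≗ i }

ListOfLength : ℕ → ℕ → Set
ListOfLength a n = Σ (List (Fin a)) λ xs → length xs ≡ n

listsOfLength : ∀ a n → List (ListOfLength a n)
listsOfLength a zero    = ([] , refl) ∷ []
listsOfLength a (suc n) = concatMap (λ x → map (λ (xs , p) → x ∷ xs , cong suc p) (listsOfLength a n)) (allFin a)

listsOfLength-complete : ∀ a n xs (p : length xs ≡ n) → (xs , p) ∈ listsOfLength a n
listsOfLength-complete a .0 [] refl = here refl
listsOfLength-complete a .(suc (length xs)) (x ∷ xs) refl =
  ∈-concatMap⁺ {f = λ x → map (λ (xs , p) → x ∷ xs , cong suc p) (listsOfLength a (length xs))}
    (∈-map⁺ (λ (xs , p) → x ∷ xs , cong suc p) (listsOfLength-complete a (length xs) xs refl))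
    (∈-allFin x)

maxOf : (A → ℕ) → List A → ℕ
maxOf f = foldr (λ x acc → f x ⊔ acc) 0

maxOf-∈ : (f : A → ℕ) (xs : List A) {x : A} → x ∈ xs → f x ≤ maxOf f xs
maxOf-∈ f (x ∷ xs) (here refl) = m≤m⊔n (f x) (maxOf f xs)
maxOf-∈ f (y ∷ xs) (there p)   = m≤n⇒m≤o⊔n (f y) (maxOf-∈ f xs p)

module GraphTheory (S : Sig) where
  open Sig S

  private
    Gr : Set
    Gr = Graph S

  infixr 9 _⊙_
  _⊙_ : ∀ {G H K : Gr} → PMor S H K → PMor S G H → PMor S G K
  ψ ⊙ φ = _∘ₘ_ S ψ φ

  infix 4 _≈_
  _≈_ : ∀ {G H : Gr} → PMor S G H → PMor S G H → Set
  φ ≈ ψ = _≈ₘ_ S φ ψ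

  id-⊙ : ∀ {G H : Gr} (f : PMor S G H) → idₘ S ⊙ f ≈ f
  id-⊙ f = (λ x → >>=-identityʳ (mV f x)) , (λ x → >>=-identityʳ (mE f x))

  att-image : ∀ {G H : Gr} (φ : PMor S G H) e e' → mE φ e ≡ just e' → ∀ v → v ∈ att G e →
    ∃[ w ] (w ∈ att H e' × mV φ v ≡ just w)
  att-image {G} {H} φ e e' eq v = mapJust-∈⁺ (mV φ) (att G e) (att H e') (proj₂ (mor φ e e' eq))

  att-preimage : ∀ {G H : Gr} (φ : PMor S G H) e e' → mE φ e ≡ just e' → ∀ w → w ∈ att H e' →
    ∃[ v ] (v ∈ att G e × mV φ v ≡ just w)
  att-preimage {G} {H} φ e e' eq w = mapJust-∈⁻ (mV φ) (att G e) (att H e') (proj₂ (mor φ e e' eq))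

  module Restriction (K : Gr) (PV : Fin (nV K) → Bool) (PE : Fin (nE K) → Bool)
    (closed : ∀ e → PE e ≡ true → ∀ v → v ∈ att K e → PV v ≡ true) where

    embV : Fin (count (nV K) PV) → Fin (nV K)
    embV = embed (nV K) PV
    embE : Fin (count (nE K) PE) → Fin (nE K)
    embE = embed (nE K) PE
    indexV : Fin (nV K) → Maybe (Fin (count (nV K) PV))
    indexV = index (nV K) PV
    indexE : Fin (nE K) → Maybe (Fin (count (nE K) PE))
    indexE = index (nE K) PE

    indexV-embV : ∀ i → indexV (embV i) ≡ just i
    indexV-embV = index-embed (nV K) PV
    indexE-embE : ∀ i → indexE (embE i) ≡ just i
    indexE-embE = index-embed (nE K) PE

    reindex : (xs : List (Fin (nV K))) → (∀ v → v ∈ xs → PV v ≡ true) → List (Fin (count (nV K) PV))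
    reindex []       sel = []
    reindex (x ∷ xs) sel = proj₁ (index-true _ PV x (sel x (here refl))) ∷ reindex xs (λ v p → sel v (there p))

    reindex-embed : ∀ xs sel → map embV (reindex xs sel) ≡ xs
    reindex-embed []       sel = refl
    reindex-embed (x ∷ xs) sel = cong₂ _∷_
      (embed-index _ PV x _ (proj₂ (index-true _ PV x (sel x (here refl)))))
      (reindex-embed xs (λ v p → sel v (there p)))

    reindex-index : ∀ xs sel → map indexV xs ≡ map just (reindex xs sel)
    reindex-index []       sel = refl
    reindex-index (x ∷ xs) sel = cong₂ _∷_ (proj₂ (index-true _ PV x (sel x (here refl))))
      (reindex-index xs (λ v p → sel v (there p)))

    reindex-length : ∀ xs sel → length (reindex xs sel) ≡ length xs
    reindex-length []       sel = refl
    reindex-length (x ∷ xs) sel = cong suc (reindex-length xs (λ v p → sel v (there p)))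

    attRes : Fin (count (nE K) PE) → List (Fin (count (nV K) PV))
    attRes e = reindex (att K (embE e)) (closed (embE e) (embed-true _ PE e))

    Res : Gr
    Res = record
      { nV = count (nV K) PV ; nE = count (nE K) PE ; att = attRes
      ; lab = λ e → lab K (embE e)
      ; arity = λ e → trans (reindex-length (att K (embE e)) _) (arity K (embE e)) }

    attRes-embed : ∀ e → map embV (attRes e) ≡ att K (embE e)
    attRes-embed e = reindex-embed _ _

    inclusion : PMor S Res K
    inclusion = record { mV = λ v → just (embV v) ; mE = λ e → just (embE e) ; mor = ok }
      where
      ok : IsMor S Res K (λ v → just (embV v)) (λ e → just (embE e))
      ok e .(embE e) refl = refl , trans (map-∘ {g = just} (attRes e)) (cong (map just) (attRes-embed e))

    restriction : PMor S K Res
    restriction = record { mV = indexV ; mE = indexE ; mor = ok }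
      where
      ok : IsMor S K Res indexV indexE
      ok e e' eq with embed-index _ PE e e' eq
      ... | refl = refl , reindex-index _ _

    inclusion-totInj : TotInj S inclusion
    inclusion-totInj = ((λ _ → ≡⇒Is-just refl) , (λ _ → ≡⇒Is-just refl)) ,
      (λ x y z p q → embed-injective _ PV x y (just-injective (trans p (sym q)))) ,
      (λ x y z p q → embed-injective _ PE x y (just-injective (trans p (sym q))))

    restriction-subgraph : SubgraphMor S restriction
    restriction-subgraph =
      ((λ x y z → index-injective _ PV x y z) , (λ x y z → index-injective _ PE x y z)) ,
      ((λ i → embV i , indexV-embV i) , (λ i → embE i , indexE-embE i))

  -- 𝒢_k is closed under taking subgraphs: a total injective morphism maps undirected
  -- paths to undirected paths of the same length.
  InGk-reflect : ∀ {A B : Gr} (f : PMor S A B) → TotInj S f → ∀ k → InGk S k B → InGk S k A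
  InGk-reflect {A} {B} f ((totV , totE) , (injV , injE)) k gkB n vs es (vs-inj , es-inj , inc) =
    gkB n (λ i → fV (vs i)) (λ i → fE (es i)) (fvs-inj , fes-inj , λ i → inc-image (proj₁ (inc i)) , inc-image (proj₂ (inc i)))
    where
    fV : Fin (nV A) → Fin (nV B)
    fV v = proj₁ (Is-just⇒≡ (totV v))
    fE : Fin (nE A) → Fin (nE B)
    fE e = proj₁ (Is-just⇒≡ (totE e))
    fV-eq : ∀ v → mV f v ≡ just (fV v)
    fV-eq v = proj₂ (Is-just⇒≡ (totV v))
    fE-eq : ∀ e → mE f e ≡ just (fE e)
    fE-eq e = proj₂ (Is-just⇒≡ (totE e))
    fvs-inj : Injective _≡_ _≡_ (λ i → fV (vs i))
    fvs-inj {i} {j} eq = vs-inj (injV (vs i) (vs j) _ (fV-eq (vs i)) (trans (fV-eq (vs j)) (cong just (sym eq))))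
    fes-inj : Injective _≡_ _≡_ (λ i → fE (es i))
    fes-inj {i} {j} eq = es-inj (injE (es i) (es j) _ (fE-eq (es i)) (trans (fE-eq (es j)) (cong just (sym eq))))
    inc-image : ∀ {v e} → v ∈ att A e → fV v ∈ att B (fE e)
    inc-image {v} {e} p with att-image f e (fE e) (fE-eq e) v p
    ... | w , w∈ , fv with trans (sym fv) (fV-eq v)
    ... | refl = w∈

  -- Proof: the partial identity χ₂ on the jointly covered
  -- part of G₃ satisfies the same equations as the identity, so by uniqueness of the
  -- mediating morphism it agrees with the identity, i.e. everything is covered.
  module JointlySurjective {G₀ G₁ G₂ G₃ : Gr} (φ : PMor S G₀ G₁) (ψ : PMor S G₀ G₂)
    (ψ' : PMor S G₁ G₃) (φ' : PMor S G₂ G₃) (po : IsPushout S φ ψ ψ' φ') where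

    CoveredV : Fin (nV G₃) → Set
    CoveredV y = (∃[ x ] (mV ψ' x ≡ just y)) ⊎ (∃[ x ] (mV φ' x ≡ just y))
    CoveredE : Fin (nE G₃) → Set
    CoveredE y = (∃[ x ] (mE ψ' x ≡ just y)) ⊎ (∃[ x ] (mE φ' x ≡ just y))

    coveredV? : ∀ y → Dec (CoveredV y)
    coveredV? y = preimage? (mV ψ') y ⊎-dec preimage? (mV φ') y
    coveredE? : ∀ y → Dec (CoveredE y)
    coveredE? y = preimage? (mE ψ') y ⊎-dec preimage? (mE φ') y

    covered-att : ∀ e → CoveredE e → ∀ v → v ∈ att G₃ e → CoveredV v
    covered-att e (inj₁ (x , p)) v q = let v' , _ , r = att-preimage ψ' x e p v q in inj₁ (v' , r)
    covered-att e (inj₂ (x , p)) v q = let v' , _ , r = att-preimage φ' x e p v q in inj₂ (v' , r)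

    χ₂ : PMor S G₃ G₃
    χ₂ = record { mV = partialId coveredV? ; mE = partialId coveredE? ; mor = ok }
      where
      ok : IsMor S G₃ G₃ (partialId coveredV?) (partialId coveredE?)
      ok e e' eq with partialId-just coveredE? e e' eq
      ... | cov , refl =
        refl , map-cong-local (All.tabulate λ {v} p → partialId-yes coveredV? v (covered-att e cov v p))

    fixes : ∀ {X : Set} {n} {P : Fin n → Set} (d : ∀ y → Dec (P y)) (f : X → Maybe (Fin n)) →
      (∀ x y → f x ≡ just y → P y) → ∀ x → (f x >>= partialId d) ≡ f x
    fixes d f inP x with f x in eq
    ... | just y  = partialId-yes d y (inP x y eq)
    ... | nothing = refl

    χ₂-ψ' : χ₂ ⊙ ψ' ≈ ψ'
    χ₂-ψ' = fixes coveredV? (mV ψ') (λ x y p → inj₁ (x , p)) , fixes coveredE? (mE ψ') (λ x y p → inj₁ (x , p))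
    χ₂-φ' : χ₂ ⊙ φ' ≈ φ'
    χ₂-φ' = fixes coveredV? (mV φ') (λ x y p → inj₂ (x , p)) , fixes coveredE? (mE φ') (λ x y p → inj₂ (x , p))

    -- χ₂ and the identity both mediate the cocone (ψ', φ'), hence coincide
    χ₂≈id : χ₂ ≈ idₘ S
    χ₂≈id =
      let _ , _ , unique = proj₂ po G₃ ψ' φ' (proj₁ po)
          χ₂≈χ = unique χ₂ χ₂-ψ' χ₂-φ' ; id≈χ = unique (idₘ S) (id-⊙ ψ') (id-⊙ φ') in
      (λ y → trans (proj₁ χ₂≈χ y) (sym (proj₁ id≈χ y))) , (λ y → trans (proj₂ χ₂≈χ y) (sym (proj₂ id≈χ y)))

    coveredV : ∀ y → CoveredV y
    coveredV y = proj₁ (partialId-just coveredV? y y (proj₁ χ₂≈id y))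
    coveredE : ∀ y → CoveredE y
    coveredE y = proj₁ (partialId-just coveredE? y y (proj₂ χ₂≈id y))

    boundV : nV G₃ ≤ nV G₁ + nV G₂
    boundV = cover-bound (mV ψ') (mV φ') coveredV
    boundE : nE G₃ ≤ nE G₁ + nE G₂
    boundE = cover-bound (mE ψ') (mE φ') coveredE

  -- An instantiation step glues one copy of some L_u onto L̄
  -- along a pushout, so by joint surjectivity it adds at most max_u |L_u| elements; hence
  -- an instantiation of length n has at most |L| + n · max_u |L_u| nodes (resp. edges).
  -- The statement is made for any size measure that is subadditive over pushouts.
  instantiation-bound : (size : Gr → ℕ) →
    (∀ {G₀ G₁ G₂ G₃} (φ : PMor S G₀ G₁) (ψ : PMor S G₀ G₂) (ψ' : PMor S G₁ G₃) (φ' : PMor S G₂ G₃) →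
      IsPushout S φ ψ ψ' φ' → size G₃ ≤ size G₁ + size G₂) →
    ∀ {ρ n Lb π Rb γ} → Inst S ρ n Lb π Rb γ → size Lb ≤ size (L ρ) + n * maxOf (λ u → size (Lu u)) (U ρ)
  instantiation-bound size subadd {ρ} inst0 = m≤m+n (size (L ρ)) _
  instantiation-bound size subadd {ρ} {suc n} (instS {Lb = Lb} {π = π} i u u∈ Lbu p' π' po _ _ _ _ _ _ _) =
    begin
      size Lbu                         ≤⟨ subadd π (p u) p' π' po ⟩
      size Lb + size (Lu u)            ≤⟨ +-mono-≤ (instantiation-bound size subadd i) (maxOf-∈ (λ u → size (Lu u)) (U ρ) u∈) ⟩
      (size (L ρ) + n * M) + M         ≡⟨ +-assoc (size (L ρ)) (n * M) M ⟩
      size (L ρ) + (n * M + M)         ≡⟨ cong (size (L ρ) +_) (+-comm (n * M) M) ⟩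
      size (L ρ) + suc n * M           ∎
    where
    open ≤-Reasoning
    M : ℕ
    M = maxOf (λ u → size (Lu u)) (U ρ)

  -- Gluing: the disjoint union of graphs X and Y, in which the edges of Y are re-attached
  -- along a map  route  from the nodes of Y to the nodes of the union.  Both the test
  -- graph of the complement analysis and the explicit pushout below are of this form.
  module Glue (X Y : Gr) (route : Fin (nV Y) → Fin (nV X + nV Y)) where

    attGlue : Fin (nE X) ⊎ Fin (nE Y) → List (Fin (nV X + nV Y))
    attGlue (inj₁ x) = map (_↑ˡ nV Y) (att X x)
    attGlue (inj₂ y) = map route (att Y y)

    labGlue : Fin (nE X) ⊎ Fin (nE Y) → Fin nLab
    labGlue (inj₁ x) = lab X x
    labGlue (inj₂ y) = lab Y y

    arityGlue : ∀ x → length (attGlue x) ≡ ar (labGlue x)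
    arityGlue (inj₁ x) = trans (length-map _ (att X x)) (arity X x)
    arityGlue (inj₂ y) = trans (length-map _ (att Y y)) (arity Y y)

    Glued : Gr
    Glued = record { nV = nV X + nV Y ; nE = nE X + nE Y
                   ; att = λ x → attGlue (splitAt (nE X) x)
                   ; lab = λ x → labGlue (splitAt (nE X) x)
                   ; arity = λ x → arityGlue (splitAt (nE X) x) }

    att-l : ∀ x → att Glued (x ↑ˡ nE Y) ≡ map (_↑ˡ nV Y) (att X x)
    att-l x = cong attGlue (splitAt-↑ˡ (nE X) x (nE Y))
    lab-l : ∀ x → lab Glued (x ↑ˡ nE Y) ≡ lab X x
    lab-l x = cong labGlue (splitAt-↑ˡ (nE X) x (nE Y))
    att-r : ∀ y → att Glued (nE X ↑ʳ y) ≡ map route (att Y y)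
    att-r y = cong attGlue (splitAt-↑ʳ (nE X) (nE Y) y)
    lab-r : ∀ y → lab Glued (nE X ↑ʳ y) ≡ lab Y y
    lab-r y = cong labGlue (splitAt-↑ʳ (nE X) (nE Y) y)

    inl : PMor S X Glued
    inl = record { mV = λ x → just (x ↑ˡ nV Y) ; mE = λ x → just (x ↑ˡ nE Y) ; mor = ok }
      where
      ok : IsMor S X Glued (λ x → just (x ↑ˡ nV Y)) (λ x → just (x ↑ˡ nE Y))
      ok x .(x ↑ˡ nE Y) refl = lab-l x , trans (map-∘ (att X x)) (cong (map just) (sym (att-l x)))

  -- Mapping G into a test
  -- graph T = G ⊎ G' (where G' keeps its own copy of everything outside the image of m)
  -- shows that φ' is defined and injective outside the image of m, that this part does
  -- not meet the image of m', and hence bounds the size of G' by |L̄| + |G| -- for edges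
  -- under the proviso that there are no dangling edges (below).
  module ComplementAnalysis {Lb R' G G' : Gr} (φ : PMor S Lb R') (m : PMor S Lb G') (m-ti : TotInj S m)
    (m' : PMor S R' G) (φ' : PMor S G' G) (po : IsPushout S φ m m' φ') where

    InImV : Fin (nV G') → Set
    InImV v = ∃[ l ] (mV m l ≡ just v)
    InImE : Fin (nE G') → Set
    InImE e = ∃[ l ] (mE m l ≡ just e)

    m-totalV : ∀ l → ∃[ v ] (mV m l ≡ just v)
    m-totalV l = Is-just⇒≡ (proj₁ (proj₁ m-ti) l)
    m-totalE : ∀ l → ∃[ e ] (mE m l ≡ just e)
    m-totalE l = Is-just⇒≡ (proj₂ (proj₁ m-ti) l)

    TV : ℕ
    TV = nV G + nV G'
    TE : ℕ
    TE = nE G + nE G'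

    tagAt : ∀ v → Dec (InImV v) → Maybe (Fin (nV G)) → Fin TV
    tagAt v (yes _) (just w) = w ↑ˡ nV G'
    tagAt v (yes _) nothing  = nV G ↑ʳ v
    tagAt v (no _)  _        = nV G ↑ʳ v

    tagV : Fin (nV G') → Fin TV
    tagV v = tagAt v (preimage? (mV m) v) (mV φ' v)

    open Glue G G' tagV renaming (Glued to T)

    sepAt : ∀ v → Dec (InImV v) → Maybe (Fin (nV G)) → Maybe (Fin TV)
    sepAt v (yes _) x = Maybe.map (_↑ˡ nV G') x
    sepAt v (no _)  _ = just (nV G ↑ʳ v)

    sepV : Fin (nV G') → Maybe (Fin TV)
    sepV v = sepAt v (preimage? (mV m) v) (mV φ' v)

    sepV-im : ∀ v → InImV v → sepV v ≡ Maybe.map (_↑ˡ nV G') (mV φ' v)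
    sepV-im v i with preimage? (mV m) v
    ... | yes _ = refl
    ... | no ¬i = ⊥-elim (¬i i)

    sepV-nim : ∀ v → ¬ InImV v → sepV v ≡ just (nV G ↑ʳ v)
    sepV-nim v ¬i with preimage? (mV m) v
    ... | yes i = ⊥-elim (¬i i)
    ... | no _  = refl

    sepV-tagV : ∀ v t → sepV v ≡ just t → t ≡ tagV v
    sepV-tagV v t = go (preimage? (mV m) v) (mV φ' v)
      where
      go : ∀ d x → sepAt v d x ≡ just t → t ≡ tagAt v d x
      go (yes _) (just w) refl = refl
      go (no _)  _        refl = refl

    SepDefined : Fin (nV G') → Set
    SepDefined v = ∃[ t ] (sepV v ≡ just t)

    sepEAt : ∀ e → Dec (InImE e) → Dec (All SepDefined (att G' e)) → Maybe (Fin (nE G)) → Maybe (Fin TE)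
    sepEAt e (yes _) _       x = Maybe.map (_↑ˡ nE G') x
    sepEAt e (no _)  (yes _) _ = just (nE G ↑ʳ e)
    sepEAt e (no _)  (no _)  _ = nothing

    allSepDefined? : ∀ e → Dec (All SepDefined (att G' e))
    allSepDefined? e = All.all? (λ v → isJust? (sepV v)) (att G' e)

    sepE : Fin (nE G') → Maybe (Fin TE)
    sepE e = sepEAt e (preimage? (mE m) e) (allSepDefined? e) (mE φ' e)

    sepE-im : ∀ e → InImE e → sepE e ≡ Maybe.map (_↑ˡ nE G') (mE φ' e)
    sepE-im e i with preimage? (mE m) e
    ... | yes _ = refl
    ... | no ¬i = ⊥-elim (¬i i)

    sepE-nim : ∀ e → ¬ InImE e → All SepDefined (att G' e) → sepE e ≡ just (nE G ↑ʳ e)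
    sepE-nim e ¬i defined with preimage? (mE m) e | allSepDefined? e
    ... | yes i | _       = ⊥-elim (¬i i)
    ... | no _  | yes _   = refl
    ... | no _  | no ¬defined = ⊥-elim (¬defined defined)

    map-just-map : ∀ {X Y : Set} (f : X → Y) (xs : List X) → map (Maybe.map f) (map just xs) ≡ map just (map f xs)
    map-just-map f [] = refl
    map-just-map f (x ∷ xs) = cong (just (f x) ∷_) (map-just-map f xs)

    sep-mor-left : ∀ e w → InImE e → mE φ' e ≡ just w →
      lab T (w ↑ˡ nE G') ≡ lab G' e × map sepV (att G' e) ≡ map just (att T (w ↑ˡ nE G'))
    sep-mor-left e w (le , mle) φ'e = trans (lab-l w) (proj₁ (mor φ' e w φ'e)) , (begin
        map sepV (att G' e)
          ≡⟨ map-cong-local (All.tabulate λ {v} p → sepV-im v (let v' , _ , q = att-preimage m le e mle v p in v' , q)) ⟩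
        map (λ v → Maybe.map (_↑ˡ nV G') (mV φ' v)) (att G' e)
          ≡⟨ map-∘ (att G' e) ⟩
        map (Maybe.map (_↑ˡ nV G')) (map (mV φ') (att G' e))
          ≡⟨ cong (map (Maybe.map (_↑ˡ nV G'))) (proj₂ (mor φ' e w φ'e)) ⟩
        map (Maybe.map (_↑ˡ nV G')) (map just (att G w))
          ≡⟨ map-just-map (_↑ˡ nV G') (att G w) ⟩
        map just (map (_↑ˡ nV G') (att G w))
          ≡⟨ cong (map just) (sym (att-l w)) ⟩
        map just (att T (w ↑ˡ nE G')) ∎)
      where open ≡-Reasoning

    sep-mor-right : ∀ e → All SepDefined (att G' e) →
      lab T (nE G ↑ʳ e) ≡ lab G' e × map sepV (att G' e) ≡ map just (att T (nE G ↑ʳ e))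
    sep-mor-right e defined = lab-r e , (begin
        map sepV (att G' e)
          ≡⟨ map-cong-local (All.map (λ {v} (t , q) → trans q (cong just (sepV-tagV v t q))) defined) ⟩
        map (λ v → just (tagV v)) (att G' e)
          ≡⟨ map-∘ (att G' e) ⟩
        map just (map tagV (att G' e))
          ≡⟨ cong (map just) (sym (att-r e)) ⟩
        map just (att T (nE G ↑ʳ e)) ∎)
      where open ≡-Reasoning

    sepE-mor : IsMor S G' T sepV sepE
    sepE-mor e t = go (preimage? (mE m) e) (allSepDefined? e) (mE φ' e) refl
      where
      go : ∀ d₁ d₂ x → mE φ' e ≡ x → sepEAt e d₁ d₂ x ≡ just t →
        lab T t ≡ lab G' e × map sepV (att G' e) ≡ map just (att T t)
      go (yes i) _         (just w) φ'e refl = sep-mor-left e w i φ'e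
      go (no _)  (yes defined) _        _   refl = sep-mor-right e defined

    sep : PMor S G' T
    sep = record { mV = sepV ; mE = sepE ; mor = sepE-mor }

    -- (inl ∘ m', sep) is a cocone over φ and m, since sep agrees with inl ∘ φ' on the image of m
    cocone : (inl ⊙ m') ⊙ φ ≈ sep ⊙ m
    cocone = coconeV , coconeE
      where
      coconeV : ∀ l → (mV φ l >>= λ r → mV m' r >>= λ w → just (w ↑ˡ nV G')) ≡ (mV m l >>= sepV)
      coconeV l with m-totalV l
      ... | v , ml = begin
        (mV φ l >>= λ r → mV m' r >>= λ w → just (w ↑ˡ nV G')) ≡⟨ sym (>>=-assoc (mV φ l) (mV m') _) ⟩
        ((mV φ l >>= mV m') >>= λ w → just (w ↑ˡ nV G'))     ≡⟨ cong (_>>= _) (proj₁ (proj₁ po) l) ⟩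
        ((mV m l >>= mV φ') >>= λ w → just (w ↑ˡ nV G'))     ≡⟨ cong (λ z → (z >>= mV φ') >>= _) ml ⟩
        (mV φ' v >>= λ w → just (w ↑ˡ nV G'))                ≡⟨ sym (map-as->>= (_↑ˡ nV G') (mV φ' v)) ⟩
        Maybe.map (_↑ˡ nV G') (mV φ' v)                      ≡⟨ sym (sepV-im v (l , ml)) ⟩
        sepV v                                               ≡⟨ cong (_>>= sepV) (sym ml) ⟩
        (mV m l >>= sepV)                                    ∎
        where open ≡-Reasoning
      coconeE : ∀ l → (mE φ l >>= λ r → mE m' r >>= λ w → just (w ↑ˡ nE G')) ≡ (mE m l >>= sepE)
      coconeE l with m-totalE l
      ... | e , ml = begin
        (mE φ l >>= λ r → mE m' r >>= λ w → just (w ↑ˡ nE G')) ≡⟨ sym (>>=-assoc (mE φ l) (mE m') _) ⟩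
        ((mE φ l >>= mE m') >>= λ w → just (w ↑ˡ nE G'))     ≡⟨ cong (_>>= _) (proj₂ (proj₁ po) l) ⟩
        ((mE m l >>= mE φ') >>= λ w → just (w ↑ˡ nE G'))     ≡⟨ cong (λ z → (z >>= mE φ') >>= _) ml ⟩
        (mE φ' e >>= λ w → just (w ↑ˡ nE G'))                ≡⟨ sym (map-as->>= (_↑ˡ nE G') (mE φ' e)) ⟩
        Maybe.map (_↑ˡ nE G') (mE φ' e)                      ≡⟨ sym (sepE-im e (l , ml)) ⟩
        sepE e                                               ≡⟨ cong (_>>= sepE) (sym ml) ⟩
        (mE m l >>= sepE)                                    ∎
        where open ≡-Reasoning

    mediating : Σ (PMor S G T) λ χ → χ ⊙ m' ≈ inl ⊙ m' × χ ⊙ φ' ≈ sep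
    mediating = let χ , commutes , _ = proj₂ po T (inl ⊙ m') sep cocone in χ , commutes

    χ : PMor S G T
    χ = proj₁ mediating

    χ-m' : χ ⊙ m' ≈ inl ⊙ m'
    χ-m' = proj₁ (proj₂ mediating)

    χ-φ' : χ ⊙ φ' ≈ sep
    χ-φ' = proj₂ (proj₂ mediating)

    outsideV : ∀ v → ¬ InImV v → ∃[ w ] (mV φ' v ≡ just w × mV χ w ≡ just (nV G ↑ʳ v))
    outsideV v ¬i = >>=-just⁻ (mV φ' v) (mV χ) (trans (proj₁ χ-φ' v) (sepV-nim v ¬i))

    outsideE : ∀ e → ¬ InImE e → All SepDefined (att G' e) → ∃[ w ] (mE φ' e ≡ just w × mE χ w ≡ just (nE G ↑ʳ e))
    outsideE e ¬i defined = >>=-just⁻ (mE φ' e) (mE χ) (trans (proj₂ χ-φ' e) (sepE-nim e ¬i defined))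

    χ-on-m'V : ∀ r w → mV m' r ≡ just w → mV χ w ≡ just (w ↑ˡ nV G')
    χ-on-m'V r w eq with trans (sym (cong (_>>= mV χ) eq)) (proj₁ χ-m' r)
    ... | q rewrite eq = q

    χ-on-m'E : ∀ r w → mE m' r ≡ just w → mE χ w ≡ just (w ↑ˡ nE G')
    χ-on-m'E r w eq with trans (sym (cong (_>>= mE χ) eq)) (proj₂ χ-m' r)
    ... | q rewrite eq = q

    Dangling : Fin (nE G') → Set
    Dangling e = ¬ InImE e × ∃[ v ] (v ∈ att G' e × InImV v × mV φ' v ≡ nothing)

    rightV : Fin TV → Maybe (Fin (nV G'))
    rightV x = [ (λ _ → nothing) , just ]′ (splitAt (nV G) x)
    rightE : Fin TE → Maybe (Fin (nE G'))
    rightE x = [ (λ _ → nothing) , just ]′ (splitAt (nE G) x)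

    boundV : nV G' ≤ nV Lb + nV G
    boundV = cover-bound (mV m) (λ w → mV χ w >>= rightV) covered
      where
      covered : ∀ v → InImV v ⊎ ∃[ w ] ((mV χ w >>= rightV) ≡ just v)
      covered v with preimage? (mV m) v
      ... | yes i = inj₁ i
      ... | no ¬i = let w , _ , q = outsideV v ¬i in
        inj₂ (w , trans (cong (_>>= rightV) q) (cong [ (λ _ → nothing) , just ]′ (splitAt-↑ʳ (nV G) (nV G') v)))

    dangling : ∀ e → ¬ InImE e → ¬ All SepDefined (att G' e) → Dangling e
    dangling e ¬i ¬all with find (¬All⇒Any¬ (λ v → isJust? (sepV v)) (att G' e) ¬all)
    ... | v , v∈ , ¬def with preimage? (mV m) v
    ... | no ¬iv = ⊥-elim (¬def (_ , refl))
    ... | yes iv with mV φ' v in eq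
    ... | nothing = ¬i , v , v∈ , iv , eq
    ... | just w  = ⊥-elim (¬def (w ↑ˡ nV G' , refl))

    boundE : (∀ e → ¬ Dangling e) → nE G' ≤ nE Lb + nE G
    boundE noDangling = cover-bound (mE m) (λ w → mE χ w >>= rightE) covered
      where
      covered : ∀ e → InImE e ⊎ ∃[ w ] ((mE χ w >>= rightE) ≡ just e)
      covered e with preimage? (mE m) e
      ... | yes i = inj₁ i
      ... | no ¬i with allSepDefined? e
      ... | no ¬all = ⊥-elim (noDangling e (dangling e ¬i ¬all))
      ... | yes defined = let w , _ , q = outsideE e ¬i defined in
        inj₂ (w , trans (cong (_>>= rightE) q) (cong [ (λ _ → nothing) , just ]′ (splitAt-↑ʳ (nE G) (nE G') e)))

    disjointV : ∀ v r w → ¬ InImV v → mV φ' v ≡ just w → mV m' r ≡ just w → ⊥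
    disjointV v r w ¬i p q with outsideV v ¬i
    ... | w' , p' , c with trans (sym p) p'
    ... | refl = ↑ˡ≢↑ʳ (just-injective (trans (sym (χ-on-m'V r w q)) c))

    injectiveV : ∀ v₁ v₂ w → ¬ InImV v₁ → ¬ InImV v₂ → mV φ' v₁ ≡ just w → mV φ' v₂ ≡ just w → v₁ ≡ v₂
    injectiveV v₁ v₂ w ¬i₁ ¬i₂ p₁ p₂ with outsideV v₁ ¬i₁ | outsideV v₂ ¬i₂
    ... | w₁ , q₁ , c₁ | w₂ , q₂ , c₂ with trans (sym p₁) q₁ | trans (sym p₂) q₂
    ... | refl | refl = ↑ʳ-injective (nV G) v₁ v₂ (just-injective (trans (sym c₁) c₂))

    mapped⇒allSepDefined : ∀ e w → mE φ' e ≡ just w → All SepDefined (att G' e)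
    mapped⇒allSepDefined e w eq = All.tabulate λ {v} p → defined v (att-image φ' e w eq v p)
      where
      defined : ∀ v → ∃[ w' ] (w' ∈ att G w × mV φ' v ≡ just w') → SepDefined v
      defined v (w' , _ , q) with preimage? (mV m) v
      ... | yes i rewrite q = w' ↑ˡ nV G' , refl
      ... | no ¬i = _ , refl

    disjointE : ∀ e r w → ¬ InImE e → mE φ' e ≡ just w → mE m' r ≡ just w → ⊥
    disjointE e r w ¬i p q with outsideE e ¬i (mapped⇒allSepDefined e w p)
    ... | w' , p' , c with trans (sym p) p'
    ... | refl = ↑ˡ≢↑ʳ (just-injective (trans (sym (χ-on-m'E r w q)) c))

    injectiveE : ∀ e₁ e₂ w → ¬ InImE e₁ → ¬ InImE e₂ → mE φ' e₁ ≡ just w → mE φ' e₂ ≡ just w → e₁ ≡ e₂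
    injectiveE e₁ e₂ w ¬i₁ ¬i₂ p₁ p₂
      with outsideE e₁ ¬i₁ (mapped⇒allSepDefined e₁ w p₁) | outsideE e₂ ¬i₂ (mapped⇒allSepDefined e₂ w p₂)
    ... | w₁ , q₁ , c₁ | w₂ , q₂ , c₂ with trans (sym p₁) q₁ | trans (sym p₂) q₂
    ... | refl | refl = ↑ʳ-injective (nE G) e₁ e₂ (just-injective (trans (sym c₁) c₂))

  module EdgeDeletion {Lb R' G G' : Gr} (φ : PMor S Lb R') (m : PMor S Lb G') (m-ti : TotInj S m)
    (m' : PMor S R' G) (φ' : PMor S G' G) (po : IsPushout S φ m m' φ')
    (PE : Fin (nE G') → Bool)
    (keeps-image : ∀ l e → mE m l ≡ just e → PE e ≡ true)
    (keeps-domain : ∀ e w → mE φ' e ≡ just w → PE e ≡ true) where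

    open Restriction G' (λ _ → true) PE (λ _ _ _ _ → refl) public

    G'' : Gr
    G'' = Res

    m'' : PMor S Lb G''
    m'' = restriction ⊙ m

    φ'' : PMor S G'' G
    φ'' = φ' ⊙ inclusion

    keptV : ∀ v → ∃[ i ] (indexV v ≡ just i)
    keptV v = index-true _ (λ _ → true) v refl

    keptE : ∀ l → ∃[ e ] (mE m l ≡ just e × ∃[ i ] (indexE e ≡ just i))
    keptE l = let e , eq = Is-just⇒≡ (proj₂ (proj₁ m-ti) l) in e , eq , index-true _ PE e (keeps-image l e eq)

    m''-totInj : TotInj S m''
    m''-totInj = (totalV , totalE) , injectiveV , injectiveE
      where
      totalV : ∀ l → Is-just (mV m l >>= indexV)
      totalV l = let v , q = Is-just⇒≡ (proj₁ (proj₁ m-ti) l) ; i , r = keptV v in ≡⇒Is-just (trans (cong (_>>= indexV) q) r)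
      totalE : ∀ l → Is-just (mE m l >>= indexE)
      totalE l = let e , q , i , r = keptE l in ≡⇒Is-just (trans (cong (_>>= indexE) q) r)
      injectiveV : PInjective S (mV m'')
      injectiveV l₁ l₂ z p₁ p₂ =
        let v₁ , q₁ , r₁ = >>=-just⁻ (mV m l₁) indexV p₁ ; v₂ , q₂ , r₂ = >>=-just⁻ (mV m l₂) indexV p₂ in
        proj₁ (proj₂ m-ti) l₁ l₂ v₁ q₁ (trans q₂ (cong just (sym (index-injective _ _ v₁ v₂ z r₁ r₂))))
      injectiveE : PInjective S (mE m'')
      injectiveE l₁ l₂ z p₁ p₂ =
        let e₁ , q₁ , r₁ = >>=-just⁻ (mE m l₁) indexE p₁ ; e₂ , q₂ , r₂ = >>=-just⁻ (mE m l₂) indexE p₂ in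
        proj₂ (proj₂ m-ti) l₁ l₂ e₁ q₁ (trans q₂ (cong just (sym (index-injective _ _ e₁ e₂ z r₁ r₂))))

    φ'-factorsV : ∀ v → (indexV v >>= mV φ'') ≡ mV φ' v
    φ'-factorsV v = let i , r = keptV v in index->>=-embed _ _ (mV φ') v i r

    φ'-factorsE : ∀ e → (indexE e >>= mE φ'') ≡ mE φ' e
    φ'-factorsE e with PE e in kept
    ... | true  = let i , r = index-true _ PE e kept in index->>=-embed _ _ (mE φ') e i r
    ... | false with mE φ' e in eq
    ...   | nothing = cong (_>>= mE φ'') (index-false _ PE e kept)
    ...   | just w  with trans (sym kept) (keeps-domain e w eq)
    ...     | ()


    along-φ'⇒ : ∀ {X : Gr} (f : PMor S G X) (g : PMor S G'' X) → f ⊙ φ'' ≈ g → f ⊙ φ' ≈ g ⊙ restriction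
    along-φ'⇒ f g eq = (λ v → along (mV φ') (mV φ'') (mV f) (mV g) indexV φ'-factorsV (proj₁ eq) v) ,
                       (λ e → along (mE φ') (mE φ'') (mE f) (mE g) indexE φ'-factorsE (proj₂ eq) e)
      where
      along : ∀ {A B C D : Set} (φ₁ : A → Maybe B) (φ₂ : C → Maybe B) (h : B → Maybe D) (k : C → Maybe D)
        (ι : A → Maybe C) → (∀ a → (ι a >>= φ₂) ≡ φ₁ a) → (∀ c → (φ₂ c >>= h) ≡ k c) → ∀ a → (φ₁ a >>= h) ≡ (ι a >>= k)
      along φ₁ φ₂ h k ι fact eq a = begin
        (φ₁ a >>= h)                   ≡⟨ cong (_>>= h) (sym (fact a)) ⟩
        ((ι a >>= φ₂) >>= h)           ≡⟨ >>=-assoc (ι a) φ₂ h ⟩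
        (ι a >>= λ c → φ₂ c >>= h)     ≡⟨ >>=-cong (ι a) eq ⟩
        (ι a >>= k)                    ∎
        where open ≡-Reasoning

    ⇐along-φ' : ∀ {X : Gr} (f : PMor S G X) (g : PMor S G'' X) → f ⊙ φ' ≈ g ⊙ restriction → f ⊙ φ'' ≈ g
    ⇐along-φ' f g eq = (λ x → trans (proj₁ eq (embV x)) (cong (_>>= mV g) (indexV-embV x))) ,
                       (λ x → trans (proj₂ eq (embE x)) (cong (_>>= mE g) (indexE-embE x)))

    pushout'' : IsPushout S φ m'' m' φ''
    pushout'' = commutes , universal
      where
      commutes : m' ⊙ φ ≈ φ'' ⊙ m''
      commutes = (λ l → trans (proj₁ (proj₁ po) l) (sym (trans (>>=-assoc (mV m l) indexV (mV φ'')) (>>=-cong (mV m l) φ'-factorsV)))) ,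
                 (λ l → trans (proj₂ (proj₁ po) l) (sym (trans (>>=-assoc (mE m l) indexE (mE φ'')) (>>=-cong (mE m l) φ'-factorsE))))
      universal : (H : Gr) (a : PMor S R' H) (b : PMor S G'' H) → a ⊙ φ ≈ b ⊙ m'' →
        Σ (PMor S G H) λ χ → (χ ⊙ m' ≈ a × χ ⊙ φ'' ≈ b) × (∀ χ' → χ' ⊙ m' ≈ a → χ' ⊙ φ'' ≈ b → χ' ≈ χ)
      universal H a b cone with proj₂ po H a (b ⊙ restriction) cone'
        where
        cone' : a ⊙ φ ≈ (b ⊙ restriction) ⊙ m
        cone' = (λ l → trans (proj₁ cone l) (>>=-assoc (mV m l) indexV (mV b))) ,
                (λ l → trans (proj₂ cone l) (>>=-assoc (mE m l) indexE (mE b)))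
      ... | χ , (χ-m' , χ-φ') , unique =
        χ , (χ-m' , ⇐along-φ' χ b χ-φ') , λ χ' χ'-m' χ'-φ'' → unique χ' χ'-m' (along-φ'⇒ χ' b χ'-φ'')

  -- A ⊑-minimal pushout complement in 𝒢_k has no dangling edges: deleting a dangling edge
  -- yields a pushout complement in 𝒢_k with strictly fewer edges which is a subgraph, so
  -- minimality would give a surjection from fewer edges onto more.
  module MinimalComplement {Lb R' G G' : Gr} (φ : PMor S Lb R') (m : PMor S Lb G') (m-ti : TotInj S m)
    (m' : PMor S R' G) (φ' : PMor S G' G) (po : IsPushout S φ m m' φ') (k : ℕ) (gk : InGk S k G')
    (minimal : ∀ G'' → Σ (PMor S Lb G'') (POCk S k φ m' G'') → _⊑_ S G'' G' → _⊑_ S G' G'') where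

    open ComplementAnalysis φ m m-ti m' φ' po using (Dangling; boundE)

    module DeleteDangling (e₀ : Fin (nE G')) (d : Dangling e₀) where
      keep : Fin (nE G') → Bool
      keep e = not (does (e ≟F e₀))

      keep-other : ∀ e → ¬ e ≡ e₀ → keep e ≡ true
      keep-other e e≢e₀ = cong not (dec-false (e ≟F e₀) e≢e₀)

      keeps-image : ∀ l e → mE m l ≡ just e → keep e ≡ true
      keeps-image l e eq = keep-other e λ { refl → proj₁ d (l , eq) }

      -- φ' is undefined on e₀, because it is undefined on one of its nodes
      keeps-domain : ∀ e w → mE φ' e ≡ just w → keep e ≡ true
      keeps-domain e w eq = keep-other e λ { refl →
        let _ , v₀∈ , _ , φ'v₀ = proj₂ d ; _ , _ , φ'v₀' = att-image φ' e₀ w eq _ v₀∈ in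
        case trans (sym φ'v₀) φ'v₀' of λ () }

      open EdgeDeletion φ m m-ti m' φ' po keep keeps-image keeps-domain public

      complement'' : Σ (PMor S Lb G'') (POCk S k φ m' G'')
      complement'' = m'' , m''-totInj , InGk-reflect inclusion inclusion-totInj k gk , φ'' , pushout''

      fewer-edges : nE G'' < nE G'
      fewer-edges = count-< (nE G') keep e₀ (cong not (dec-true (e₀ ≟F e₀) refl))

    no-dangling : ∀ e₀ → ¬ Dangling e₀
    no-dangling e₀ d = <⇒≱ fewer-edges (surjection-bound (mE σ) (proj₂ (proj₂ (proj₂ G'⊑G''))))
      where
      open DeleteDangling e₀ d
      G'⊑G'' : _⊑_ S G' G''
      G'⊑G'' = minimal G'' complement'' (restriction , restriction-subgraph)
      σ : PMor S G'' G'
      σ = proj₁ G'⊑G''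

    boundE-minimal : nE G' ≤ nE Lb + nE G
    boundE-minimal = boundE no-dangling

  -- The pushout of a total injective match m : L̄ → G' and a partial γ : L̄ ⇀ R̄, built
  -- explicitly: glue R̄ onto G', routing each node/edge in the image of m to its γ-image
  -- (when γ is defined there), then delete the copies of the image of m and every edge
  -- of G' whose attachment nodes are not all kept.  This realises a rewrite step G' ⇒ H.
  module PushoutOfMatch {Lb Rb G' : Gr} (m : PMor S Lb G') (m-ti : TotInj S m) (γ : PMor S Lb Rb) where

    InImV : Fin (nV G') → Set
    InImV v = ∃[ l ] (mV m l ≡ just v)
    InImE : Fin (nE G') → Set
    InImE e = ∃[ l ] (mE m l ≡ just e)

    m-injV : PInjective S (mV m)
    m-injV = proj₁ (proj₂ m-ti)
    m-injE : PInjective S (mE m)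
    m-injE = proj₂ (proj₂ m-ti)

    m-totalV : ∀ l → ∃[ v ] (mV m l ≡ just v)
    m-totalV l = Is-just⇒≡ (proj₁ (proj₁ m-ti) l)
    m-totalE : ∀ l → ∃[ e ] (mE m l ≡ just e)
    m-totalE l = Is-just⇒≡ (proj₂ (proj₁ m-ti) l)

    routeViaV : Fin (nV G') → Maybe (Fin (nV Rb)) → Fin (nV Rb + nV G')
    routeViaV v (just r) = r ↑ˡ nV G'
    routeViaV v nothing  = nV Rb ↑ʳ v

    routeAtV : ∀ v → Dec (InImV v) → Fin (nV Rb + nV G')
    routeAtV v (yes (l , _)) = routeViaV v (mV γ l)
    routeAtV v (no _)        = nV Rb ↑ʳ v

    routeV : Fin (nV G') → Fin (nV Rb + nV G')
    routeV v = routeAtV v (preimage? (mV m) v)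

    routeViaE : Fin (nE G') → Maybe (Fin (nE Rb)) → Fin (nE Rb + nE G')
    routeViaE e (just r) = r ↑ˡ nE G'
    routeViaE e nothing  = nE Rb ↑ʳ e

    routeAtE : ∀ e → Dec (InImE e) → Fin (nE Rb + nE G')
    routeAtE e (yes (l , _)) = routeViaE e (mE γ l)
    routeAtE e (no _)        = nE Rb ↑ʳ e

    routeE : Fin (nE G') → Fin (nE Rb + nE G')
    routeE e = routeAtE e (preimage? (mE m) e)

    routeV-im : ∀ l v → mV m l ≡ just v → routeV v ≡ routeViaV v (mV γ l)
    routeV-im l v q with preimage? (mV m) v
    ... | yes (l' , p) rewrite m-injV l' l v p q = refl
    ... | no ¬i = ⊥-elim (¬i (l , q))

    routeV-nim : ∀ v → ¬ InImV v → routeV v ≡ nV Rb ↑ʳ v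
    routeV-nim v ¬i with preimage? (mV m) v
    ... | yes i = ⊥-elim (¬i i)
    ... | no _  = refl

    routeE-im : ∀ l e → mE m l ≡ just e → routeE e ≡ routeViaE e (mE γ l)
    routeE-im l e q with preimage? (mE m) e
    ... | yes (l' , p) rewrite m-injE l' l e p q = refl
    ... | no ¬i = ⊥-elim (¬i (l , q))

    routeE-nim : ∀ e → ¬ InImE e → routeE e ≡ nE Rb ↑ʳ e
    routeE-nim e ¬i with preimage? (mE m) e
    ... | yes i = ⊥-elim (¬i i)
    ... | no _  = refl

    open Glue Rb G' routeV renaming (Glued to K; inl to inlR)

    keepVAt : Fin (nV Rb) ⊎ Fin (nV G') → Bool
    keepVAt (inj₁ _) = true
    keepVAt (inj₂ v) = isNo (preimage? (mV m) v)

    keepV : Fin (nV Rb + nV G') → Bool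
    keepV x = keepVAt (splitAt (nV Rb) x)

    keepV-l : ∀ r → keepV (r ↑ˡ nV G') ≡ true
    keepV-l r = cong keepVAt (splitAt-↑ˡ (nV Rb) r (nV G'))

    keepV-im : ∀ v → InImV v → keepV (nV Rb ↑ʳ v) ≡ false
    keepV-im v i rewrite splitAt-↑ʳ (nV Rb) (nV G') v with preimage? (mV m) v
    ... | yes _ = refl
    ... | no ¬i = ⊥-elim (¬i i)

    keepV-nim : ∀ v → ¬ InImV v → keepV (nV Rb ↑ʳ v) ≡ true
    keepV-nim v ¬i rewrite splitAt-↑ʳ (nV Rb) (nV G') v with preimage? (mV m) v
    ... | yes i = ⊥-elim (¬i i)
    ... | no _  = refl

    keepV-r⇒nim : ∀ v → keepV (nV Rb ↑ʳ v) ≡ true → ¬ InImV v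
    keepV-r⇒nim v t i with trans (sym t) (keepV-im v i)
    ... | ()

    deletedV : ∀ v → keepV (routeV v) ≡ false → ∃[ l ] (mV m l ≡ just v × mV γ l ≡ nothing)
    deletedV v f with preimage? (mV m) v
    ... | no ¬i with trans (sym f) (keepV-nim v ¬i)
    ...   | ()
    deletedV v f | yes (l , p) with mV γ l in eq
    ... | nothing = l , p , eq
    ... | just r with trans (sym f) (keepV-l r)
    ...   | ()

    keepEAt : Fin (nE Rb) ⊎ Fin (nE G') → Bool
    keepEAt (inj₁ _) = true
    keepEAt (inj₂ e) = isNo (preimage? (mE m) e) ∧ all (λ v → keepV (routeV v)) (att G' e)

    keepE : Fin (nE Rb + nE G') → Bool
    keepE x = keepEAt (splitAt (nE Rb) x)

    keepE-l : ∀ r → keepE (r ↑ˡ nE G') ≡ true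
    keepE-l r = cong keepEAt (splitAt-↑ˡ (nE Rb) r (nE G'))

    keepE-im : ∀ e → InImE e → keepE (nE Rb ↑ʳ e) ≡ false
    keepE-im e i rewrite splitAt-↑ʳ (nE Rb) (nE G') e with preimage? (mE m) e
    ... | yes _ = refl
    ... | no ¬i = ⊥-elim (¬i i)

    keepE-r⇒nim : ∀ e → keepE (nE Rb ↑ʳ e) ≡ true → ¬ InImE e
    keepE-r⇒nim e t i with trans (sym t) (keepE-im e i)
    ... | ()

    deletedE : ∀ e → keepE (routeE e) ≡ false →
      (∃[ l ] (mE m l ≡ just e × mE γ l ≡ nothing)) ⊎ (∃[ v ] (v ∈ att G' e × keepV (routeV v) ≡ false))
    deletedE e f with preimage? (mE m) e
    ... | yes (l , p) with mE γ l in eq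
    ...   | nothing = inj₁ (l , p , eq)
    ...   | just r with trans (sym f) (keepE-l r)
    ...     | ()
    deletedE e f | no ¬i rewrite splitAt-↑ʳ (nE Rb) (nE G') e with preimage? (mE m) e
    ... | yes i = ⊥-elim (¬i i)
    ... | no _  = inj₂ (all-false _ (att G' e) f)

    keep-closed : ∀ x → keepE x ≡ true → ∀ v → v ∈ att K x → keepV v ≡ true
    keep-closed x = closedAt (splitAt (nE Rb) x)
      where
      closedAt : ∀ s → keepEAt s ≡ true → ∀ v → v ∈ attGlue s → keepV v ≡ true
      closedAt (inj₁ r) t v p with ∈-map⁻ (_↑ˡ nV G') p
      ... | r' , _ , refl = keepV-l r'
      closedAt (inj₂ e) t v p with ∈-map⁻ routeV p
      ... | v' , v'∈ , refl = all-true _ (att G' e) (∧-trueʳ {isNo (preimage? (mE m) e)} t) v'∈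

    kept-right⇒nimV : ∀ x v → splitAt (nV Rb) x ≡ inj₂ v → keepV x ≡ true → ¬ InImV v
    kept-right⇒nimV x v eq kept = keepV-r⇒nim v (trans (cong keepV (splitAt⁻¹-↑ʳ eq)) kept)

    kept-right⇒nimE : ∀ x e → splitAt (nE Rb) x ≡ inj₂ e → keepE x ≡ true → ¬ InImE e
    kept-right⇒nimE x e eq kept = keepE-r⇒nim e (trans (cong keepE (splitAt⁻¹-↑ʳ eq)) kept)

    route-mor : ∀ e → lab K (routeE e) ≡ lab G' e × att K (routeE e) ≡ map routeV (att G' e)
    route-mor e with preimage? (mE m) e
    ... | no _ = lab-r e , att-r e
    ... | yes (le , p) with mE γ le in eq
    ...   | nothing = lab-r e , att-r e
    ...   | just r  = trans (lab-l r) (trans (proj₁ (mor γ le r eq)) (sym (proj₁ (mor m le e p)))) ,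
                      trans (att-l r) (sym (mapJust-zip (mV m) (mV γ) routeV (_↑ˡ nV G') (att Lb le) (att G' e) (att Rb r)
                        (proj₂ (mor m le e p)) (proj₂ (mor γ le r eq))
                        (λ x y z mx γx → trans (routeV-im x y mx) (cong (routeViaV y) γx))))

    routing : PMor S G' K
    routing = record { mV = λ v → just (routeV v) ; mE = λ e → just (routeE e) ; mor = ok }
      where
      ok : IsMor S G' K (λ v → just (routeV v)) (λ e → just (routeE e))
      ok e .(routeE e) refl = proj₁ (route-mor e) , trans (map-∘ (att G' e)) (cong (map just) (sym (proj₂ (route-mor e))))

    open Restriction K keepV keepE keep-closed public

    H : Gr
    H = Res

    gH : PMor S G' H
    gH = restriction ⊙ routing
    rH : PMor S Rb H
    rH = restriction ⊙ inlR

    commutes : gH ⊙ m ≈ rH ⊙ γ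
    commutes = commutesV , commutesE
      where
      commutesV : ∀ l → (mV m l >>= mV gH) ≡ (mV γ l >>= mV rH)
      commutesV l with m-totalV l
      ... | v , q rewrite q | routeV-im l v q with mV γ l
      ... | just r  = refl
      ... | nothing = index-false _ keepV (nV Rb ↑ʳ v) (keepV-im v (l , q))
      commutesE : ∀ l → (mE m l >>= mE gH) ≡ (mE γ l >>= mE rH)
      commutesE l with m-totalE l
      ... | e , q rewrite q | routeE-im l e q with mE γ l
      ... | just r  = refl
      ... | nothing = index-false _ keepE (nE Rb ↑ʳ e) (keepE-im e (l , q))

    -- The universal property.  A cocone (a, b) over m and γ induces the copairing
    -- [b, a] : K ⇀ X, which factors through H because a vanishes wherever K was cut.
    module Mediating (X : Gr) (a : PMor S G' X) (b : PMor S Rb X) (cone : a ⊙ m ≈ b ⊙ γ) where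

      copairV : Fin (nV K) → Maybe (Fin (nV X))
      copairV x = [ mV b , mV a ]′ (splitAt (nV Rb) x)
      copairE : Fin (nE K) → Maybe (Fin (nE X))
      copairE x = [ mE b , mE a ]′ (splitAt (nE Rb) x)

      copairV-l : ∀ r → copairV (r ↑ˡ nV G') ≡ mV b r
      copairV-l r = cong [ mV b , mV a ]′ (splitAt-↑ˡ (nV Rb) r (nV G'))
      copairV-r : ∀ v → copairV (nV Rb ↑ʳ v) ≡ mV a v
      copairV-r v = cong [ mV b , mV a ]′ (splitAt-↑ʳ (nV Rb) (nV G') v)
      copairE-l : ∀ r → copairE (r ↑ˡ nE G') ≡ mE b r
      copairE-l r = cong [ mE b , mE a ]′ (splitAt-↑ˡ (nE Rb) r (nE G'))
      copairE-r : ∀ e → copairE (nE Rb ↑ʳ e) ≡ mE a e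
      copairE-r e = cong [ mE b , mE a ]′ (splitAt-↑ʳ (nE Rb) (nE G') e)

      a-on-imageV : ∀ l v → mV m l ≡ just v → mV a v ≡ (mV γ l >>= mV b)
      a-on-imageV l v q = trans (cong (_>>= mV a) (sym q)) (proj₁ cone l)
      a-on-imageE : ∀ l e → mE m l ≡ just e → mE a e ≡ (mE γ l >>= mE b)
      a-on-imageE l e q = trans (cong (_>>= mE a) (sym q)) (proj₂ cone l)

      copair-routeV : ∀ v → copairV (routeV v) ≡ mV a v
      copair-routeV v with preimage? (mV m) v
      ... | no _ = copairV-r v
      ... | yes (l , p) with mV γ l in eq
      ...   | nothing = copairV-r v
      ...   | just r  = trans (copairV-l r) (sym (trans (a-on-imageV l v p) (cong (_>>= mV b) eq)))

      copair-routeE : ∀ e → copairE (routeE e) ≡ mE a e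
      copair-routeE e with preimage? (mE m) e
      ... | no _ = copairE-r e
      ... | yes (l , p) with mE γ l in eq
      ...   | nothing = copairE-r e
      ...   | just r  = trans (copairE-l r) (sym (trans (a-on-imageE l e p) (cong (_>>= mE b) eq)))

      copair-mor : IsMor S K X copairV copairE
      copair-mor x x' = go (splitAt (nE Rb) x) refl
        where
        go : ∀ s → splitAt (nE Rb) x ≡ s → [ mE b , mE a ]′ s ≡ just x' →
          lab X x' ≡ lab K x × map copairV (att K x) ≡ map just (att X x')
        go (inj₁ r) eqs eq = trans (proj₁ (mor b r x' eq)) (sym (cong labGlue eqs)) , (begin
          map copairV (attGlue (splitAt (nE Rb) x))  ≡⟨ cong (λ s → map copairV (attGlue s)) eqs ⟩
          map copairV (map (_↑ˡ nV G') (att Rb r))   ≡⟨ sym (map-∘ (att Rb r)) ⟩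
          map (λ r' → copairV (r' ↑ˡ nV G')) (att Rb r) ≡⟨ map-cong copairV-l (att Rb r) ⟩
          map (mV b) (att Rb r)                      ≡⟨ proj₂ (mor b r x' eq) ⟩
          map just (att X x')                        ∎)
          where open ≡-Reasoning
        go (inj₂ e) eqs eq = trans (proj₁ (mor a e x' eq)) (sym (cong labGlue eqs)) , (begin
          map copairV (attGlue (splitAt (nE Rb) x))  ≡⟨ cong (λ s → map copairV (attGlue s)) eqs ⟩
          map copairV (map routeV (att G' e))        ≡⟨ sym (map-∘ (att G' e)) ⟩
          map (λ v → copairV (routeV v)) (att G' e)  ≡⟨ map-cong copair-routeV (att G' e) ⟩
          map (mV a) (att G' e)                      ≡⟨ proj₂ (mor a e x' eq) ⟩
          map just (att X x')                        ∎)
          where open ≡-Reasoning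

      copair : PMor S K X
      copair = record { mV = copairV ; mE = copairE ; mor = copair-mor }

      χ : PMor S H X
      χ = copair ⊙ inclusion

      -- a is undefined on deleted nodes (their γ-preimage is undefined)
      a-deletedV : ∀ v → keepV (routeV v) ≡ false → mV a v ≡ nothing
      a-deletedV v f = let l , p , q = deletedV v f in trans (a-on-imageV l v p) (cong (_>>= mV b) q)

      -- ... and on deleted edges (φ' would otherwise be defined on a deleted node)
      a-deletedE : ∀ e → keepE (routeE e) ≡ false → mE a e ≡ nothing
      a-deletedE e f with deletedE e f
      ... | inj₁ (l , p , q) = trans (a-on-imageE l e p) (cong (_>>= mE b) q)
      ... | inj₂ (v , v∈ , fv) with mE a e in ae
      ...   | nothing = refl
      ...   | just y with att-image a e y ae v v∈
      ...     | _ , _ , av with trans (sym (a-deletedV v fv)) av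
      ...       | ()

      χ-rH : χ ⊙ rH ≈ b
      χ-rH = (λ r → trans (index->>=-embed _ keepV copairV (r ↑ˡ nV G') _ (proj₂ (index-true _ keepV _ (keepV-l r)))) (copairV-l r)) ,
             (λ r → trans (index->>=-embed _ keepE copairE (r ↑ˡ nE G') _ (proj₂ (index-true _ keepE _ (keepE-l r)))) (copairE-l r))

      χ-gH : χ ⊙ gH ≈ a
      χ-gH = χ-gHV , χ-gHE
        where
        χ-gHV : ∀ v → (indexV (routeV v) >>= λ h → copairV (embV h)) ≡ mV a v
        χ-gHV v with keepV (routeV v) in kept
        ... | true  = trans (index->>=-embed _ keepV copairV (routeV v) _ (proj₂ (index-true _ keepV _ kept))) (copair-routeV v)
        ... | false rewrite index-false _ keepV (routeV v) kept = sym (a-deletedV v kept)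
        χ-gHE : ∀ e → (indexE (routeE e) >>= λ h → copairE (embE h)) ≡ mE a e
        χ-gHE e with keepE (routeE e) in kept
        ... | true  = trans (index->>=-embed _ keepE copairE (routeE e) _ (proj₂ (index-true _ keepE _ kept))) (copair-routeE e)
        ... | false rewrite index-false _ keepE (routeE e) kept = sym (a-deletedE e kept)

      -- every node and edge of H comes from R̄ via rH or from G' via gH, so a morphism out
      -- of H is determined by its composites with rH and gH
      unique : ∀ χ' → χ' ⊙ gH ≈ a → χ' ⊙ rH ≈ b → χ' ≈ χ
      unique χ' χ'-gH χ'-rH = uniqueV , uniqueE
        where
        uniqueV : ∀ h → mV χ' h ≡ copairV (embV h)
        uniqueV h with splitAt (nV Rb) (embV h) in eqs
        ... | inj₁ r = trans (cong (_>>= mV χ') (sym (trans (cong indexV (splitAt⁻¹-↑ˡ eqs)) (indexV-embV h)))) (proj₁ χ'-rH r)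
        ... | inj₂ v = trans (cong (_>>= mV χ') (sym (trans (cong indexV routed) (indexV-embV h)))) (proj₁ χ'-gH v)
          where
          routed : routeV v ≡ embV h
          routed = trans (routeV-nim v (kept-right⇒nimV (embV h) v eqs (embed-true _ keepV h))) (splitAt⁻¹-↑ʳ eqs)
        uniqueE : ∀ h → mE χ' h ≡ copairE (embE h)
        uniqueE h with splitAt (nE Rb) (embE h) in eqs
        ... | inj₁ r = trans (cong (_>>= mE χ') (sym (trans (cong indexE (splitAt⁻¹-↑ˡ eqs)) (indexE-embE h)))) (proj₂ χ'-rH r)
        ... | inj₂ e = trans (cong (_>>= mE χ') (sym (trans (cong indexE routed) (indexE-embE h)))) (proj₂ χ'-gH e)
          where
          routed : routeE e ≡ embE h
          routed = trans (routeE-nim e (kept-right⇒nimE (embE h) e eqs (embed-true _ keepE h))) (splitAt⁻¹-↑ʳ eqs)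

    pushout : IsPushout S m γ gH rH
    pushout = commutes , λ X a b cone → let open Mediating X a b cone in χ , (χ-gH , χ-rH) , unique

  -- Suppose G is the pushout of μ ∘ γ and m, where
  -- μ : R̄ ⇀ R' is a subgraph morphism and m' : R' → G is total injective.  Then the
  -- mediating morphism from the rewrite result H (the pushout of m and γ) to G is
  -- injective and surjective, so G ⊑ H: the predecessor G' rewrites into ↑{G}.
  module Comparison {Lb Rb R' G G' : Gr} (γ : PMor S Lb Rb) (μ : PMor S Rb R') (μ-sub : SubgraphMor S μ)
    (m' : PMor S R' G) (m'-ti : TotInj S m') (m : PMor S Lb G') (m-ti : TotInj S m) (φ' : PMor S G' G)
    (po : IsPushout S (μ ⊙ γ) m m' φ') where

    open PushoutOfMatch m m-ti γ
    module C = ComplementAnalysis (μ ⊙ γ) m m-ti m' φ' po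
    module J = JointlySurjective (μ ⊙ γ) m m' φ' po

    b : PMor S Rb G
    b = m' ⊙ μ

    cone : φ' ⊙ m ≈ b ⊙ γ
    cone = (λ l → trans (sym (proj₁ (proj₁ po) l)) (>>=-assoc (mV γ l) (mV μ) (mV m'))) ,
           (λ l → trans (sym (proj₂ (proj₁ po) l)) (>>=-assoc (mE γ l) (mE μ) (mE m')))

    open Mediating G φ' b cone

    b-injV : ∀ r₁ r₂ g → mV b r₁ ≡ just g → mV b r₂ ≡ just g → r₁ ≡ r₂
    b-injV r₁ r₂ g p₁ p₂ with >>=-just⁻ (mV μ r₁) (mV m') p₁ | >>=-just⁻ (mV μ r₂) (mV m') p₂
    ... | r₁' , q₁ , t₁ | r₂' , q₂ , t₂ with proj₁ (proj₂ m'-ti) r₁' r₂' g t₁ t₂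
    ... | refl = proj₁ (proj₁ μ-sub) r₁ r₂ r₁' q₁ q₂

    b-injE : ∀ r₁ r₂ g → mE b r₁ ≡ just g → mE b r₂ ≡ just g → r₁ ≡ r₂
    b-injE r₁ r₂ g p₁ p₂ with >>=-just⁻ (mE μ r₁) (mE m') p₁ | >>=-just⁻ (mE μ r₂) (mE m') p₂
    ... | r₁' , q₁ , t₁ | r₂' , q₂ , t₂ with proj₂ (proj₂ m'-ti) r₁' r₂' g t₁ t₂
    ... | refl = proj₂ (proj₁ μ-sub) r₁ r₂ r₁' q₁ q₂

    -- the copairing [b, φ'] is injective on the kept part of K: b and φ' are injective
    -- there and have disjoint images (complement analysis)
    copairV-injective : ∀ x y g → keepV x ≡ true → keepV y ≡ true → copairV x ≡ just g → copairV y ≡ just g → x ≡ y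
    copairV-injective x y g kx ky px py with splitAt (nV Rb) x in ex | splitAt (nV Rb) y in ey
    ... | inj₁ r₁ | inj₁ r₂ = trans (sym (splitAt⁻¹-↑ˡ ex)) (trans (cong (_↑ˡ nV G') (b-injV r₁ r₂ g px py)) (splitAt⁻¹-↑ˡ ey))
    ... | inj₂ v₁ | inj₂ v₂ = trans (sym (splitAt⁻¹-↑ʳ ex)) (trans (cong (nV Rb ↑ʳ_)
            (C.injectiveV v₁ v₂ g (isNo-true (preimage? (mV m) v₁) kx) (isNo-true (preimage? (mV m) v₂) ky) px py)) (splitAt⁻¹-↑ʳ ey))
    ... | inj₁ r₁ | inj₂ v₂ = let r' , _ , t = >>=-just⁻ (mV μ r₁) (mV m') px in
                              ⊥-elim (C.disjointV v₂ r' g (isNo-true (preimage? (mV m) v₂) ky) py t)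
    ... | inj₂ v₁ | inj₁ r₂ = let r' , _ , t = >>=-just⁻ (mV μ r₂) (mV m') py in
                              ⊥-elim (C.disjointV v₁ r' g (isNo-true (preimage? (mV m) v₁) kx) px t)

    copairE-injective : ∀ x y g → keepE x ≡ true → keepE y ≡ true → copairE x ≡ just g → copairE y ≡ just g → x ≡ y
    copairE-injective x y g kx ky px py with splitAt (nE Rb) x in ex | splitAt (nE Rb) y in ey
    ... | inj₁ r₁ | inj₁ r₂ = trans (sym (splitAt⁻¹-↑ˡ ex)) (trans (cong (_↑ˡ nE G') (b-injE r₁ r₂ g px py)) (splitAt⁻¹-↑ˡ ey))
    ... | inj₂ e₁ | inj₂ e₂ = trans (sym (splitAt⁻¹-↑ʳ ex)) (trans (cong (nE Rb ↑ʳ_)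
            (C.injectiveE e₁ e₂ g (isNo-true (preimage? (mE m) e₁) (∧-trueˡ kx)) (isNo-true (preimage? (mE m) e₂) (∧-trueˡ ky)) px py)) (splitAt⁻¹-↑ʳ ey))
    ... | inj₁ r₁ | inj₂ e₂ = let r' , _ , t = >>=-just⁻ (mE μ r₁) (mE m') px in
                              ⊥-elim (C.disjointE e₂ r' g (isNo-true (preimage? (mE m) e₂) (∧-trueˡ ky)) py t)
    ... | inj₂ e₁ | inj₁ r₂ = let r' , _ , t = >>=-just⁻ (mE μ r₂) (mE m') py in
                              ⊥-elim (C.disjointE e₁ r' g (isNo-true (preimage? (mE m) e₁) (∧-trueˡ kx)) px t)

    χ-injective : Inj S χ
    χ-injective =
      (λ h₁ h₂ g p₁ p₂ → embed-injective _ keepV h₁ h₂ (copairV-injective _ _ g (embed-true _ keepV h₁) (embed-true _ keepV h₂) p₁ p₂)) ,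
      (λ h₁ h₂ g p₁ p₂ → embed-injective _ keepE h₁ h₂ (copairE-injective _ _ g (embed-true _ keepE h₁) (embed-true _ keepE h₂) p₁ p₂))

    -- every element of G in the image of m' is hit by χ, through R̄ (μ is surjective)
    via-R'V : ∀ g r' → mV m' r' ≡ just g → ∃[ h ] (mV χ h ≡ just g)
    via-R'V g r' q =
      let r , μr = proj₁ (proj₂ μ-sub) r' ; h , eh = index-true _ keepV (r ↑ˡ nV G') (keepV-l r) in
      h , trans (cong copairV (embed-index _ keepV _ h eh)) (trans (copairV-l r) (trans (cong (_>>= mV m') μr) q))

    via-R'E : ∀ g r' → mE m' r' ≡ just g → ∃[ h ] (mE χ h ≡ just g)
    via-R'E g r' q =
      let r , μr = proj₂ (proj₂ μ-sub) r' ; h , eh = index-true _ keepE (r ↑ˡ nE G') (keepE-l r) in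
      h , trans (cong copairE (embed-index _ keepE _ h eh)) (trans (copairE-l r) (trans (cong (_>>= mE m') μr) q))

    φ'-deletes : ∀ v l → mV m l ≡ just v → mV γ l ≡ nothing → mV φ' v ≡ nothing
    φ'-deletes v l p q = trans (cong (_>>= mV φ') (sym p))
      (trans (sym (proj₁ (proj₁ po) l)) (cong (λ z → (z >>= mV μ) >>= mV m') q))

    kept-if-mapped : ∀ e g → ¬ InImE e → mE φ' e ≡ just g → keepE (nE Rb ↑ʳ e) ≡ true
    kept-if-mapped e g ¬i φ'e rewrite splitAt-↑ʳ (nE Rb) (nE G') e with preimage? (mE m) e
    ... | yes i = ⊥-elim (¬i i)
    ... | no _  = all-intro _ (att G' e) node-kept
      where
      node-kept : ∀ v → v ∈ att G' e → keepV (routeV v) ≡ true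
      node-kept v v∈ with keepV (routeV v) in kept
      ... | true  = refl
      ... | false with deletedV v kept
      ...   | l , p , q with att-image φ' e g φ'e v v∈
      ...     | _ , _ , φ'v with trans (sym (φ'-deletes v l p q)) φ'v
      ...       | ()

    χ-surjV : ∀ g → ∃[ h ] (mV χ h ≡ just g)
    χ-surjV g with J.coveredV g
    ... | inj₁ (r' , q) = via-R'V g r' q
    ... | inj₂ (v , q) with preimage? (mV m) v
    ...   | yes (l , p) =
            let r' , _ , t = >>=-just⁻ (mV γ l >>= mV μ) (mV m') (trans (proj₁ (proj₁ po) l) (trans (cong (_>>= mV φ') p) q)) in
            via-R'V g r' t
    ...   | no ¬i =
            let h , eh = index-true _ keepV (nV Rb ↑ʳ v) (keepV-nim v ¬i) in
            h , trans (cong copairV (embed-index _ keepV _ h eh)) (trans (copairV-r v) q)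

    χ-surjE : ∀ g → ∃[ h ] (mE χ h ≡ just g)
    χ-surjE g with J.coveredE g
    ... | inj₁ (r' , q) = via-R'E g r' q
    ... | inj₂ (e , q) with preimage? (mE m) e
    ...   | yes (l , p) =
            let r' , _ , t = >>=-just⁻ (mE γ l >>= mE μ) (mE m') (trans (proj₂ (proj₁ po) l) (trans (cong (_>>= mE φ') p) q)) in
            via-R'E g r' t
    ...   | no ¬i =
            let h , eh = index-true _ keepE (nE Rb ↑ʳ e) (kept-if-mapped e g ¬i q) in
            h , trans (cong copairE (embed-index _ keepE _ h eh)) (trans (copairE-r e) q)

    G⊑H : _⊑_ S G H
    G⊑H = χ , χ-injective , (χ-surjV , χ-surjE)

  -- Up to isomorphism there are only finitely many graphs with at most NV nodes and at
  -- most NE edges: a graph on Fin a / Fin b is determined by the label and attachment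
  -- list of each edge, and these range over a finite list.

  EdgeShape : ℕ → Set
  EdgeShape a = Σ (Fin nLab) λ l → ListOfLength a (ar l)

  edgeShapes : ∀ a → List (EdgeShape a)
  edgeShapes a = concatMap (λ l → map (l ,_) (listsOfLength a (ar l))) (allFin nLab)

  shapeOf : (G : Gr) → Fin (nE G) → EdgeShape (nV G)
  shapeOf G e = lab G e , att G e , arity G e

  shapeOf-∈ : ∀ G e → shapeOf G e ∈ edgeShapes (nV G)
  shapeOf-∈ G e = ∈-concatMap⁺ {f = λ l → map (l ,_) (listsOfLength (nV G) (ar l))}
    (∈-map⁺ (lab G e ,_) (listsOfLength-complete (nV G) _ (att G e) (arity G e))) (∈-allFin (lab G e))

  fromShapes : ∀ a b → (Fin b → EdgeShape a) → Gr
  fromShapes a b f = record { nV = a ; nE = b ; att = λ e → proj₁ (proj₂ (f e)) ; lab = λ e → proj₁ (f e)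
                            ; arity = λ e → proj₂ (proj₂ (f e)) }

  fromShapes-≅ : (G : Gr) (f : Fin (nE G) → EdgeShape (nV G)) → (∀ e → f e ≡ shapeOf G e) →
    _≅_ S G (fromShapes (nV G) (nE G) f)
  fromShapes-≅ G f f≗ = forth , back , ((λ _ → refl) , (λ _ → refl)) , ((λ _ → refl) , (λ _ → refl))
    where
    forth : PMor S G (fromShapes (nV G) (nE G) f)
    forth = record { mV = just ; mE = just ; mor = λ { e .e refl →
      cong proj₁ (f≗ e) , cong (map just) (sym (cong (λ z → proj₁ (proj₂ z)) (f≗ e))) } }
    back : PMor S (fromShapes (nV G) (nE G) f) G
    back = record { mV = just ; mE = just ; mor = λ { e .e refl →
      sym (cong proj₁ (f≗ e)) , cong (map just) (cong (λ z → proj₁ (proj₂ z)) (f≗ e)) } }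

  graphsUpTo : ℕ → ℕ → List Gr
  graphsUpTo NV NE = concatMap (λ a → concatMap (λ b → map (fromShapes a b) (functions b (edgeShapes a))) (upTo (suc NE))) (upTo (suc NV))

  graphsUpTo-complete : ∀ NV NE (G : Gr) → nV G ≤ NV → nE G ≤ NE → Σ Gr λ G'' → G'' ∈ graphsUpTo NV NE × _≅_ S G G''
  graphsUpTo-complete NV NE G nV≤ nE≤ =
    let f , f∈ , f≗ = functions-complete (nE G) (edgeShapes (nV G)) (shapeOf G) (shapeOf-∈ G) in
    fromShapes (nV G) (nE G) f ,
    ∈-concatMap⁺ {f = λ a → concatMap (λ b → map (fromShapes a b) (functions b (edgeShapes a))) (upTo (suc NE))}
      (∈-concatMap⁺ {f = λ b → map (fromShapes (nV G) b) (functions b (edgeShapes (nV G)))}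
        (∈-map⁺ (fromShapes (nV G) (nE G)) f∈) (∈-upTo⁺ (s≤s nE≤)))
      (∈-upTo⁺ (s≤s nV≤)) ,
    fromShapes-≅ G f f≗

  module PredBasis (𝓡 : UGTS S) (k : ℕ) (G : Gr) where

    N : ℕ
    N = nV G + nE G

    sizeBound : (Gr → ℕ) → Rule S → ℕ
    sizeBound size ρ = (size (L ρ) + N * maxOf (λ u → size (Lu u)) (U ρ)) + size G

    -- A basis element is a minimal pushout complement of an instantiation L̄ of bounded
    -- length: its nodes are bounded by |V_L̄| + |V_G|, its edges (having no dangling
    -- edges) by |E_L̄| + |E_G|, and L̄ is bounded by the instantiation bound.
    basis-bounded : ∀ G' → InPredBasis S 𝓡 k G G' →
      ∃[ ρ ] (ρ ∈ 𝓡 × nV G' ≤ sizeBound nV ρ × nE G' ≤ sizeBound nE ρ)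
    basis-bounded G' (ρ , ρ∈ , n , n≤N , Lb , π , Rb , γ , inst , R' , μ , μ-sub , m' , m'-ti , m , (m-ti , gk , φ' , po) , minimal , _) =
      ρ , ρ∈ ,
      ≤-trans (ComplementAnalysis.boundV (μ ⊙ γ) m m-ti m' φ' po)
        (+-monoˡ-≤ (nV G) (instBound nV (λ φ ψ ψ' φ' po → JointlySurjective.boundV φ ψ ψ' φ' po))) ,
      ≤-trans (MinimalComplement.boundE-minimal (μ ⊙ γ) m m-ti m' φ' po k gk minimal)
        (+-monoˡ-≤ (nE G) (instBound nE (λ φ ψ ψ' φ' po → JointlySurjective.boundE φ ψ ψ' φ' po)))
      where
      instBound : (size : Gr → ℕ) →
        (∀ {G₀ G₁ G₂ G₃} (φ : PMor S G₀ G₁) (ψ : PMor S G₀ G₂) (ψ' : PMor S G₁ G₃) (φ' : PMor S G₂ G₃) →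
          IsPushout S φ ψ ψ' φ' → size G₃ ≤ size G₁ + size G₂) →
        size Lb ≤ size (L ρ) + N * maxOf (λ u → size (Lu u)) (U ρ)
      instBound size subadd = ≤-trans (instantiation-bound size subadd inst)
        (+-monoʳ-≤ (size (L ρ)) (*-monoˡ-≤ (maxOf (λ u → size (Lu u)) (U ρ)) n≤N))

    predBasis-finite : FiniteUpToIso S (InPredBasis S 𝓡 k G)
    predBasis-finite = concatMap candidates 𝓡 , λ G' b →
      let ρ , ρ∈ , nV≤ , nE≤ = basis-bounded G' b
          G'' , G''∈ , G'≅G'' = graphsUpTo-complete (sizeBound nV ρ) (sizeBound nE ρ) G' nV≤ nE≤ in
      G'' , ∈-concatMap⁺ {f = candidates} G''∈ ρ∈ , G'≅G''
      where
      candidates : Rule S → List Gr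
      candidates ρ = graphsUpTo (sizeBound nV ρ) (sizeBound nE ρ)

    -- A basis element G' rewrites, with the same instantiation and match, into the
    -- explicit pushout H of m and γ, and G ⊑ H by the comparison.
    predBasis-pred : ∀ G' → InPredBasis S 𝓡 k G G' → pred S 𝓡 (up1 S G) G'
    predBasis-pred G' (ρ , ρ∈ , n , _ , Lb , π , Rb , γ , inst , R' , μ , μ-sub , m' , m'-ti , m , (m-ti , _ , φ' , po) , _ , app) =
      H , Comparison.G⊑H γ μ μ-sub m' m'-ti m m-ti φ' po ,
      ρ , ρ∈ , n , Lb , π , Rb , γ , inst , m , m-ti , app , gH , rH , pushout
      where open PushoutOfMatch m m-ti γ

    predBasis-Gk : ∀ G' → InPredBasis S 𝓡 k G G' → InGk S k G'
    predBasis-Gk G' (_ , _ , _ , _ , _ , _ , _ , _ , _ , _ , _ , _ , _ , _ , _ , (_ , gk , _) , _ , _) = gk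

lemma1 : (S : Sig) (𝓡 : UGTS S) (k : ℕ) (G : Graph S) →
    FiniteUpToIso S (InPredBasis S 𝓡 k G) ×
    (∀ G' → InPredBasis S 𝓡 k G G' → pred S 𝓡 (up1 S G) G') ×
    (∀ G' → InPredBasis S 𝓡 k G G' → InGk S k G')
lemma1 S 𝓡 k G = predBasis-finite , predBasis-pred , predBasis-Gk
  where open GraphTheory.PredBasis S 𝓡 k G
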